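{- Let $K_n$ be the complete graph with vertex set $V$, $|V|=n\ge 3$. Call a uniform representation of $K_n$ of type (N) if it has the form $S_v=\{c,x_v\}$ ($v\in V$) with $c$ a common element and the $x_v$ pairwise distinct elements different from $c$; call it of type (P) if there is a projective plane of order $k$ with point set $V$ and $S_v$ is the set of lines through $v$; call it of type (P$^-$) if there is a projective plane of order $k$ whose point set is $V\cup\{p\}$ with $p\notin V$ and $S_v$ is the set of lines of that plane through $v$; and for $n=3$ call it of type (T) if it is $\{a,b\},\{a,c\},\{b,c\}$ for three distinct elements $a,b,c$. Then: (1) for $n=3$, $\omega_u(K_3)=3$ and all minimum uniform representations of $K_3$ are of the single type (T); (2) for $n\ge 4$ with $n=k^2+k+1$ for some $k\ge 2$ such that a projective plane of order $k$ exists, $\omega_u(K_n)=n$ and all minimum uniform representations are of the single type (P); (3) for $n\ge 4$ with $n=k^2+k$ for some $k\ge 2$ such that a projective plane of order $k$ exists, $\omega_u(K_n)=n+1$ and the minimum uniform representations are of exactly two types, (N) and (P$^-$); (4) for $n\ge 4$ with $n\ne k^2+k+1$ and $n\neq k^2+k$ for all $k\ge 2$, $\omega_u(K_n)=n+1$ and all minimum uniform representations are of the single type (N).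
   Context: All graphs are finite, simple and undirected. For a finite family $\mathcal{F}$ of nonempty finite sets write $\mathbf{S}(\mathcal{F})=\bigcup_{S\in\mathcal{F}}S$. A representation of a graph $G$ is an assignment $v\mapsto S_v$ of a nonempty finite set to each vertex such that for all distinct vertices $u,v$, $|S_u\cap S_v|=1$ if $uv$ is an edge and $|S_u\cap S_v|=0$ otherwise. It is a uniform representation if the sets $S_v$ are pairwise distinct and all have the same cardinality. The uniform intersection number $\omega_u(G)$ is the minimum of $|\mathbf{S}(\mathcal{F})|$ over all uniform representations $\mathcal{F}$ of $G$; a minimum uniform representation is one attaining this minimum. A (finite) projective plane is a finite set of points with a family of subsets called lines such that every line has at least two points, any two distinct points lie on exactly one line, any two distinct lines meet in a point, and there exist four points no three on a common line; it has order $k\ge 2$ if it has $k^2+k+1$ points, $k^2+k+1$ lines, each line has $k+1$ points and each point lies on $k+1$ lines. In the statement, "type" refers to the forms of representation described in the claim (up to the choice of the underlying elements). -}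

module Defs where

open import Data.Nat using (ℕ; zero; suc; _+_; _*_; _≤_)
open import Data.Fin using (Fin; inject₁; fromℕ)
open import Data.Fin.Subset using (Subset; _∈_; _∩_; _∪_; ⋃; ∣_∣; Nonempty; ⁅_⁆; ⊥)
open import Data.Vec using (lookup; tabulate)
open import Data.List using (List)
import Data.List as List
open import Data.Product using (Σ; ∃; ∃-syntax; _×_; _,_)
open import Data.Sum using (_⊎_)
open import Relation.Binary.PropositionalEquality using (_≡_; _≢_)
open import Relation.Nullary using (¬_)
open import Function using (_⇔_)
open import Function.Definitions using (Injective)

-- Graphs on the vertex set Fin n, given by an adjacency relation.
-- (Only the relation on distinct vertices matters.)

Graph : ℕ → Set₁
Graph n = Fin n → Fin n → Set

K : (n : ℕ) → Graph n
K n u v = u ≢ v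

-- Underlying elements are taken from Fin m (any finite
-- family of finite sets can be relabelled into some Fin m); m is arbitrary,
-- so the union 𝐒(F) is in general a proper subset of Fin m.

Family : ℕ → ℕ → Set
Family n m = Fin n → Subset m

𝐒 : ∀ {n m} → Family n m → Subset m
𝐒 {n} S = ⋃ (List.tabulate {n = n} S)

IsRepresentation : ∀ {n m} → Graph n → Family n m → Set
IsRepresentation {n} G S =
  (∀ v → Nonempty (S v)) ×
  (∀ u v → u ≢ v →
     (G u v → ∣ S u ∩ S v ∣ ≡ 1) × (¬ G u v → ∣ S u ∩ S v ∣ ≡ 0))

IsUniformRepresentation : ∀ {n m} → Graph n → Family n m → Set
IsUniformRepresentation G S =
  IsRepresentation G S × Injective _≡_ _≡_ S × (∀ u v → ∣ S u ∣ ≡ ∣ S v ∣)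

UniformIntersectionNumber : ∀ {n} → Graph n → ℕ → Set
UniformIntersectionNumber {n} G w =
  (∃[ m ] Σ (Family n m) λ S → IsUniformRepresentation G S × ∣ 𝐒 S ∣ ≡ w) ×
  (∀ m (S : Family n m) → IsUniformRepresentation G S → w ≤ ∣ 𝐒 S ∣)

IsMinUniformRepresentation : ∀ {n m} → Graph n → Family n m → Set
IsMinUniformRepresentation {n} G S =
  IsUniformRepresentation G S ×
  (∀ m' (S' : Family n m') → IsUniformRepresentation G S' → ∣ 𝐒 S ∣ ≤ ∣ 𝐒 S' ∣)

record ProjectivePlane (p l : ℕ) : Set where
  field
    line          : Fin l → Subset p
    line-distinct : Injective _≡_ _≡_ line
    line-size     : ∀ i → 2 ≤ ∣ line i ∣
    two-points    : ∀ x y → x ≢ y →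
                      ∃[ i ] (x ∈ line i × y ∈ line i ×
                              (∀ j → x ∈ line j → y ∈ line j → j ≡ i))
    two-lines     : ∀ i j → i ≢ j → ∃[ x ] (x ∈ line i × x ∈ line j)
    four-points   : ∃[ a ] ∃[ b ] ∃[ c ] ∃[ d ]
                      (a ≢ b × a ≢ c × a ≢ d × b ≢ c × b ≢ d × c ≢ d ×
                       ¬ (∃[ i ] (a ∈ line i × b ∈ line i × c ∈ line i)) ×
                       ¬ (∃[ i ] (a ∈ line i × b ∈ line i × d ∈ line i)) ×
                       ¬ (∃[ i ] (a ∈ line i × c ∈ line i × d ∈ line i)) ×
                       ¬ (∃[ i ] (b ∈ line i × c ∈ line i × d ∈ line i)))

  linesThrough : Fin p → Subset l
  linesThrough x = tabulate λ i → lookup (line i) x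

HasOrder : ∀ {p l} → ProjectivePlane p l → ℕ → Set
HasOrder {p} {l} P k =
  2 ≤ k ×
  p ≡ k * k + k + 1 × l ≡ k * k + k + 1 ×
  (∀ i → ∣ ProjectivePlane.line P i ∣ ≡ k + 1) ×
  (∀ x → ∣ ProjectivePlane.linesThrough P x ∣ ≡ k + 1)

ProjectivePlaneOfOrderExists : ℕ → Set
ProjectivePlaneOfOrderExists k =
  ∃[ p ] ∃[ l ] Σ (ProjectivePlane p l) λ P → HasOrder P k

TypeN : ∀ {n m} → Family n m → Set
TypeN {n} {m} S =
  Σ (Fin m) λ c → Σ (Fin n → Fin m) λ x →
    Injective _≡_ _≡_ x × (∀ v → x v ≢ c) × (∀ v → S v ≡ ⁅ c ⁆ ∪ ⁅ x v ⁆)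

TypeP : ∀ {n m} → Family n m → Set
TypeP {n} {m} S =
  ∃[ k ] ∃[ l ] Σ (ProjectivePlane n l) λ P → HasOrder P k ×
    Σ (Fin l → Fin m) λ lab → Injective _≡_ _≡_ lab ×
      (∀ v e → (e ∈ S v) ⇔ (∃[ i ] (lab i ≡ e × v ∈ ProjectivePlane.line P i)))

-- (P⁻): a projective plane of order k with point set V ∪ {p}, p ∉ V;
-- points are Fin (suc n), vertex v is the point inject₁ v, p = fromℕ n
TypePminus : ∀ {n m} → Family n m → Set
TypePminus {n} {m} S =
  ∃[ k ] ∃[ l ] Σ (ProjectivePlane (suc n) l) λ P → HasOrder P k ×
    Σ (Fin l → Fin m) λ lab → Injective _≡_ _≡_ lab ×
      (∀ v e → (e ∈ S v) ⇔
         (∃[ i ] (lab i ≡ e × inject₁ v ∈ ProjectivePlane.line P i)))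

TypeT : ∀ {n m} → Family n m → Set
TypeT {n} {m} S =
  ∃[ a ] ∃[ b ] ∃[ c ] (a ≢ b × a ≢ c × b ≢ c ×
    (∀ v → S v ≡ ⁅ a ⁆ ∪ ⁅ b ⁆ ⊎ S v ≡ ⁅ a ⁆ ∪ ⁅ c ⁆ ⊎ S v ≡ ⁅ b ⁆ ∪ ⁅ c ⁆) ×
    (∃[ v ] S v ≡ ⁅ a ⁆ ∪ ⁅ b ⁆) × (∃[ v ] S v ≡ ⁅ a ⁆ ∪ ⁅ c ⁆) ×
    (∃[ v ] S v ≡ ⁅ b ⁆ ∪ ⁅ c ⁆))

module Submission where

-- Let S be a uniform representation of K_n, n ≥ 2: n distinct s-sets, any
-- two meeting in exactly one element; let V = |𝐒 S| and let deg x be the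
-- number of sets containing x.  Either some c lies in every set (a star) or
-- not.  In a star the other elements have degree ≤ 1, so V = 1 + n(s - 1)
-- ≥ n + 1 with equality iff s = 2, i.e. type (N).  Otherwise deg x ≤ s for
-- all x, and with the deficiencies e x = s - deg x every set has the same
-- total deficiency c, where c + s + n = s² + 1, while Σ_{x ∈ 𝐒 S} e x =
-- s (V - n).  So V ≥ n.  If V = n there are no deficiencies, n = r² + r + 1
-- (s = r + 1) and the sets of vertices through the elements are the lines of
-- a projective plane of order r on the vertices: type (P).  If V = n + 1 a
-- second-moment count gives c = 1 and e x ∈ {0, 1}, so n = r² + r, and one
-- new point on the lines of the deficient elements completes the plane:
-- type (P⁻).  For n = 3 the case V = 3 gives the triangle, type (T).
-- Conversely the family {0, v + 1}, the pencils of lines through the points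
-- of a plane (or through all but one point), and the triangle attain these
-- bounds, which determines ω_u(K_n) and all minimum representations.

open import Defs
open import Data.Nat using (ℕ; zero; suc; _+_; _*_; _∸_; _≤_; _<_; z≤n; s≤s; _≤?_; ≢-nonZero)
open import Data.Nat.Properties
open import Data.Nat.Tactic.RingSolver using (solve-∀)
open import Data.Bool using (Bool; true; false; _∧_; _∨_; if_then_else_)
open import Data.Bool.Properties using () renaming (_≟_ to _≟ᵇ_)
open import Data.Fin using (Fin; zero; suc; inject₁; fromℕ)
open import Data.Fin.Properties using (any?; all?; ¬∀⟶∃¬; inject₁-injective)
  renaming (_≟_ to _≟ᶠ_; suc-injective to fsuc-injective)
open import Data.Fin.Subset using (Subset; _∈_; _∩_; _∪_; ∣_∣; Nonempty; ⁅_⁆)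
open import Data.Fin.Subset.Properties using (x∈p∪q⁻; x∈⁅y⁆⇒x≡y)
open import Data.Vec using ([]; _∷_; lookup; tabulate)
open import Data.Vec.Properties
  using (lookup-zipWith; []=⇒lookup; lookup⇒[]=; lookup∘tabulate; tabulate∘lookup; tabulate-cong; lookup-replicate)
open import Data.Product using (Σ; ∃-syntax; _×_; _,_; proj₁; proj₂)
open import Data.Sum using (_⊎_; inj₁; inj₂)
open import Data.Empty using (⊥-elim)
open import Relation.Nullary using (¬_; yes; no; does)
open import Relation.Binary.PropositionalEquality
open import Function using (_⇔_; mk⇔)
open import Algebra.Properties.Semiring.Sum +-*-semiring
  using (sum; sum-cong-≗; ∑-distrib-+; ∑-comm; *-distribˡ-sum; sum-init-last)

sum-mono : ∀ {n} {f g : Fin n → ℕ} → (∀ i → f i ≤ g i) → sum f ≤ sum g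
sum-mono {zero}  le = z≤n
sum-mono {suc n} le = +-mono-≤ (le zero) (sum-mono (λ i → le (suc i)))

sum-const : ∀ {n} (c : ℕ) → sum {n} (λ _ → c) ≡ n * c
sum-const {zero}  c = refl
sum-const {suc n} c = cong (c +_) (sum-const {n} c)

sum-zero : ∀ {n} → sum {n} (λ _ → 0) ≡ 0
sum-zero {n} = trans (sum-const {n} 0) (*-zeroʳ n)

sum-factor-swap : ∀ {k l} (f : Fin k → ℕ) (g : Fin k → Fin l → ℕ) →
                  sum (λ a → f a * sum (g a)) ≡ sum (λ y → sum (λ a → f a * g a y))
sum-factor-swap f g = trans (sum-cong-≗ (λ a → *-distribˡ-sum (f a) (g a))) (∑-comm (λ a y → f a * g a y))

without : ∀ {n} → Fin n → (Fin n → ℕ) → Fin n → ℕ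
without v f u = if does (u ≟ᶠ v) then 0 else f u

sum-without : ∀ {n} (v : Fin n) (f : Fin n → ℕ) → sum f ≡ f v + sum (without v f)
sum-without {suc n} zero    f = cong (f zero +_) (sym (+-identityˡ _))
sum-without {suc n} (suc v) f = begin
  f zero + sum (λ i → f (suc i))           ≡⟨ cong (f zero +_) (sum-without v (λ i → f (suc i))) ⟩
  f zero + (f (suc v) + sum rest)          ≡⟨ sym (+-assoc (f zero) _ _) ⟩
  f zero + f (suc v) + sum rest            ≡⟨ cong (_+ sum rest) (+-comm (f zero) _) ⟩
  f (suc v) + f zero + sum rest            ≡⟨ +-assoc (f (suc v)) _ _ ⟩
  f (suc v) + (f zero + sum rest)          ∎
  where
  open ≡-Reasoning
  rest : Fin n → ℕ
  rest = without v (λ i → f (suc i))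

without-≢ : ∀ {n} {v u : Fin n} (f : Fin n → ℕ) → u ≢ v → without v f u ≡ f u
without-≢ {v = v} {u} f u≢v with u ≟ᶠ v
... | yes u≡v = ⊥-elim (u≢v u≡v)
... | no _    = refl

without-≤ : ∀ {n} (v u : Fin n) (f : Fin n → ℕ) → without v f u ≤ f u
without-≤ v u f with u ≟ᶠ v
... | yes _ = z≤n
... | no _  = ≤-refl

without-pos : ∀ {n} {v u : Fin n} (f : Fin n → ℕ) → 1 ≤ without v f u → u ≢ v × 1 ≤ f u
without-pos {v = v} {u} f pos with u ≟ᶠ v
... | no u≢v = u≢v , pos

term≤sum : ∀ {n} (v : Fin n) (f : Fin n → ℕ) → f v ≤ sum f
term≤sum v f = subst (f v ≤_) (sym (sum-without v f)) (m≤m+n (f v) _)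

sum≡0 : ∀ {n} (f : Fin n → ℕ) → sum f ≡ 0 → ∀ i → f i ≡ 0
sum≡0 f sum≡0 i = n≤0⇒n≡0 (subst (f i ≤_) sum≡0 (term≤sum i f))

positive-term : ∀ {n} (f : Fin n → ℕ) → 1 ≤ sum f → ∃[ i ] 1 ≤ f i
positive-term {zero}  f ()
positive-term {suc n} f pos with f zero in eq
... | suc _ = zero , subst (1 ≤_) (sym eq) (s≤s z≤n)
... | zero with positive-term (λ i → f (suc i)) pos
...   | i , p = suc i , p

two-terms≤sum : ∀ {n} {x y : Fin n} (f : Fin n → ℕ) → y ≢ x → f x + f y ≤ sum f
two-terms≤sum {x = x} {y} f y≢x = subst (f x + f y ≤_) (sym (sum-without x f))
  (+-monoʳ-≤ (f x) (subst (_≤ sum (without x f)) (without-≢ f y≢x) (term≤sum y (without x f))))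

three-terms≤sum : ∀ {n} {x y z : Fin n} (f : Fin n → ℕ) → y ≢ x → z ≢ x → z ≢ y →
                  f x + f y + f z ≤ sum f
three-terms≤sum {x = x} {y} {z} f y≢x z≢x z≢y = begin
  f x + f y + f z                          ≡⟨ +-assoc (f x) (f y) (f z) ⟩
  f x + (f y + f z)                        ≡⟨ cong (f x +_) (sym (cong₂ _+_ (without-≢ f y≢x) (without-≢ f z≢x))) ⟩
  f x + (without x f y + without x f z)    ≤⟨ +-monoʳ-≤ (f x) (two-terms≤sum (without x f) z≢y) ⟩
  f x + sum (without x f)                  ≡⟨ sym (sum-without x f) ⟩
  sum f                                    ∎
  where open ≤-Reasoning

sum≤1+sum-without : ∀ {n} (v : Fin n) (f : Fin n → ℕ) → (∀ i → f i ≤ 1) →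
                    sum f ≤ 1 + sum (without v f)
sum≤1+sum-without v f f≤1 =
  subst (_≤ 1 + sum (without v f)) (sym (sum-without v f)) (+-monoˡ-≤ _ (f≤1 v))

two-positive-terms : ∀ {n} (f : Fin n → ℕ) → (∀ i → f i ≤ 1) → 2 ≤ sum f →
                     ∃[ i ] ∃[ j ] (j ≢ i × 1 ≤ f i × 1 ≤ f j)
two-positive-terms f f≤1 two≤sum with positive-term f (≤-trans (s≤s z≤n) two≤sum)
... | i , fi with positive-term (without i f)
                   (+-cancelˡ-≤ 1 1 _ (≤-trans two≤sum (sum≤1+sum-without i f f≤1)))
...   | j , fj with without-pos f fj
...     | j≢i , fj′ = i , j , j≢i , fi , fj′

sum-tight : ∀ {n} (f g : Fin n → ℕ) → (∀ i → f i ≤ g i) → sum g ≤ sum f → ∀ i → f i ≡ g i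
sum-tight f g f≤g sum≤ i = ≤-antisym (f≤g i) (+-cancelʳ-≤ (sum (without i f)) (g i) (f i) (begin
  g i + sum (without i f)  ≤⟨ +-monoʳ-≤ (g i) (sum-mono without-mono) ⟩
  g i + sum (without i g)  ≡⟨ sym (sum-without i g) ⟩
  sum g                    ≤⟨ sum≤ ⟩
  sum f                    ≡⟨ sum-without i f ⟩
  f i + sum (without i f)  ∎))
  where
  open ≤-Reasoning
  without-mono : ∀ u → without i f u ≤ without i g u
  without-mono u with u ≟ᶠ i
  ... | yes _ = z≤n
  ... | no _  = f≤g u

sum≡1-unique : ∀ {n} (f : Fin n → ℕ) → sum f ≡ 1 → ∀ {i j} → 1 ≤ f i → 1 ≤ f j → i ≡ j
sum≡1-unique f sum≡1 {i} {j} fi fj with i ≟ᶠ j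
... | yes i≡j = i≡j
... | no i≢j  = ⊥-elim (1+n≰n (subst (2 ≤_) sum≡1
                  (≤-trans (+-mono-≤ fi fj) (two-terms≤sum f (≢-sym i≢j)))))

false≢true : false ≢ true
false≢true ()

true-or-false : ∀ b → b ≡ true ⊎ b ≡ false
true-or-false true  = inj₁ refl
true-or-false false = inj₂ refl

∧-true : ∀ {a b} → (a ∧ b) ≡ true → a ≡ true × b ≡ true
∧-true {true} b≡true = refl , b≡true

𝟙 : Bool → ℕ
𝟙 true  = 1
𝟙 false = 0

𝟙≤1 : ∀ b → 𝟙 b ≤ 1
𝟙≤1 true  = s≤s z≤n
𝟙≤1 false = z≤n

𝟙-pos : ∀ {b} → 1 ≤ 𝟙 b → b ≡ true
𝟙-pos {true} _ = refl

𝟙-true : ∀ {b} → b ≡ true → 𝟙 b ≡ 1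
𝟙-true refl = refl

𝟙-false : ∀ {b} → b ≡ false → 𝟙 b ≡ 0
𝟙-false refl = refl

𝟙-∧ : ∀ a b → 𝟙 (a ∧ b) ≡ 𝟙 a * 𝟙 b
𝟙-∧ true  b = sym (+-identityʳ (𝟙 b))
𝟙-∧ false b = refl

𝟙-idem : ∀ b → 𝟙 b * 𝟙 b ≡ 𝟙 b
𝟙-idem true  = refl
𝟙-idem false = refl

𝟙*𝟙-pos : ∀ {a b} → 1 ≤ 𝟙 a * 𝟙 b → a ≡ true × b ≡ true
𝟙*𝟙-pos {true} {true} _ = refl , refl

count≤1 : ∀ {n} (b : Fin n → Bool) → (∀ {i j} → b i ≡ true → b j ≡ true → i ≡ j) →
          sum (λ i → 𝟙 (b i)) ≤ 1
count≤1 b unique with ≤-total (sum (λ i → 𝟙 (b i))) 1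
... | inj₁ ≤1 = ≤1
... | inj₂ ≥1 with 1 ≟ sum (λ i → 𝟙 (b i))
...   | yes ≡1 = ≤-reflexive (sym ≡1)
...   | no ≢1 with two-positive-terms (λ i → 𝟙 (b i)) (λ i → 𝟙≤1 (b i)) (≤∧≢⇒< ≥1 ≢1)
...     | i , j , j≢i , bi , bj = ⊥-elim (j≢i (unique (𝟙-pos bj) (𝟙-pos bi)))

count≡1 : ∀ {n} (b : Fin n → Bool) (i : Fin n) → b i ≡ true → (∀ j → b j ≡ true → j ≡ i) →
          sum (λ j → 𝟙 (b j)) ≡ 1
count≡1 b i bi only-i = ≤-antisym
  (count≤1 b (λ bj bk → trans (only-i _ bj) (sym (only-i _ bk))))
  (≤-trans (≤-reflexive (sym (𝟙-true bi))) (term≤sum i (λ j → 𝟙 (b j))))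

𝟙*-pos : ∀ {a} k → 1 ≤ 𝟙 a * k → a ≡ true × 1 ≤ k
𝟙*-pos {true} k pos = refl , subst (1 ≤_) (+-identityʳ k) pos

is-one : ℕ → Bool
is-one (suc zero) = true
is-one _          = false

𝟙-is-one : ∀ {k} → k ≤ 1 → 𝟙 (is-one k) ≡ k
𝟙-is-one {zero}        _ = refl
𝟙-is-one {suc zero}    _ = refl
𝟙-is-one {suc (suc k)} (s≤s ())

is-one⇒≡1 : ∀ {k} → is-one k ≡ true → k ≡ 1
is-one⇒≡1 {suc zero} _ = refl

lookup-∩ : ∀ {n} (A C : Subset n) x → lookup (A ∩ C) x ≡ (lookup A x ∧ lookup C x)
lookup-∩ A C x = lookup-zipWith _∧_ x A C

lookup-∪ : ∀ {n} (A C : Subset n) x → lookup (A ∪ C) x ≡ (lookup A x ∨ lookup C x)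
lookup-∪ A C x = lookup-zipWith _∨_ x A C

lookup-⁅⁆ : ∀ {n} (i x : Fin n) → lookup ⁅ i ⁆ x ≡ does (x ≟ᶠ i)
lookup-⁅⁆ zero    zero    = refl
lookup-⁅⁆ zero    (suc x) = lookup-replicate x false
lookup-⁅⁆ (suc i) zero    = refl
lookup-⁅⁆ (suc i) (suc x) = lookup-⁅⁆ i x

∈⇒lookup : ∀ {n} {x : Fin n} {A : Subset n} → x ∈ A → lookup A x ≡ true
∈⇒lookup = []=⇒lookup

lookup⇒∈ : ∀ {n} {x : Fin n} {A : Subset n} → lookup A x ≡ true → x ∈ A
lookup⇒∈ {x = x} {A} = lookup⇒[]= x A

subset-ext : ∀ {n} (A C : Subset n) → (∀ x → lookup A x ≡ lookup C x) → A ≡ C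
subset-ext A C same = trans (sym (tabulate∘lookup A)) (trans (tabulate-cong same) (tabulate∘lookup C))

card : ∀ {n} (A : Subset n) → ∣ A ∣ ≡ sum (λ x → 𝟙 (lookup A x))
card []          = refl
card (true ∷ A)  = cong suc (card A)
card (false ∷ A) = card A

card-tabulate : ∀ {n} (f : Fin n → Bool) → ∣ tabulate f ∣ ≡ sum (λ x → 𝟙 (f x))
card-tabulate f = trans (card (tabulate f)) (sum-cong-≗ (λ x → cong 𝟙 (lookup∘tabulate f x)))

card-∩ : ∀ {n} (A C : Subset n) → ∣ A ∩ C ∣ ≡ sum (λ x → 𝟙 (lookup A x) * 𝟙 (lookup C x))
card-∩ A C = trans (card (A ∩ C))
  (sum-cong-≗ (λ x → trans (cong 𝟙 (lookup-∩ A C x)) (𝟙-∧ (lookup A x) (lookup C x))))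

nonempty : ∀ {n} (A : Subset n) → 1 ≤ ∣ A ∣ → Nonempty A
nonempty A 1≤∣A∣ with positive-term (λ x → 𝟙 (lookup A x)) (subst (1 ≤_) (card A) 1≤∣A∣)
... | x , pos = x , lookup⇒∈ (𝟙-pos pos)

two-element-set : ∀ {m} (A : Subset m) {a b : Fin m} → ∣ A ∣ ≡ 2 → b ≢ a →
                  lookup A a ≡ true → lookup A b ≡ true → A ≡ ⁅ a ⁆ ∪ ⁅ b ⁆
two-element-set A {a} {b} ∣A∣≡2 b≢a a∈A b∈A = subset-ext A _ entry
  where
  entry : ∀ y → lookup A y ≡ lookup (⁅ a ⁆ ∪ ⁅ b ⁆) y
  entry y rewrite lookup-∪ ⁅ a ⁆ ⁅ b ⁆ y | lookup-⁅⁆ a y | lookup-⁅⁆ b y with y ≟ᶠ a | y ≟ᶠ b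
  ... | yes refl | _        = a∈A
  ... | no _     | yes refl = b∈A
  ... | no y≢a   | no y≢b with lookup A y in y∈A
  ...   | false = refl
  ...   | true  = ⊥-elim (1+n≰n (subst (3 ≤_) (trans (sym (card A)) ∣A∣≡2)
            (subst (_≤ sum (λ x → 𝟙 (lookup A x)))
               (cong₂ _+_ (cong₂ _+_ (𝟙-true a∈A) (𝟙-true b∈A)) (𝟙-true y∈A))
               (three-terms≤sum (λ x → 𝟙 (lookup A x)) b≢a y≢a y≢b))))

∈-pair : ∀ {m} {a b y : Fin m} → lookup (⁅ a ⁆ ∪ ⁅ b ⁆) y ≡ true → y ≡ a ⊎ y ≡ b
∈-pair {a = a} {b} y∈ with x∈p∪q⁻ ⁅ a ⁆ ⁅ b ⁆ (lookup⇒∈ y∈)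
... | inj₁ y∈a = inj₁ (x∈⁅y⁆⇒x≡y a y∈a)
... | inj₂ y∈b = inj₂ (x∈⁅y⁆⇒x≡y b y∈b)

∨-true : ∀ {a b} → (a ∨ b) ≡ true → a ≡ true ⊎ b ≡ true
∨-true {true}  _   = inj₁ refl
∨-true {false} b≡t = inj₂ b≡t

∈𝐒⇒∈member : ∀ {n m} (S : Family n m) x → lookup (𝐒 S) x ≡ true → ∃[ v ] lookup (S v) x ≡ true
∈𝐒⇒∈member {zero}  S x x∈ = ⊥-elim (false≢true (trans (sym (lookup-replicate x false)) x∈))
∈𝐒⇒∈member {suc n} S x x∈ with ∨-true (trans (sym (lookup-∪ (S zero) _ x)) x∈)
... | inj₁ x∈S₀ = zero , x∈S₀
... | inj₂ x∈rest with ∈𝐒⇒∈member (λ i → S (suc i)) x x∈rest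
...   | v , x∈Sv = suc v , x∈Sv

∈member⇒∈𝐒 : ∀ {n m} (S : Family n m) x v → lookup (S v) x ≡ true → lookup (𝐒 S) x ≡ true
∈member⇒∈𝐒 {suc n} S x zero    x∈ =
  trans (lookup-∪ (S zero) _ x) (cong (_∨ lookup (𝐒 (λ i → S (suc i))) x) x∈)
∈member⇒∈𝐒 {suc n} S x (suc v) x∈ = trans (lookup-∪ (S zero) _ x)
  (trans (cong (lookup (S zero) x ∨_) (∈member⇒∈𝐒 (λ i → S (suc i)) x v x∈)) (∨-true-right _))
  where
  ∨-true-right : ∀ b → (b ∨ true) ≡ true
  ∨-true-right true  = refl
  ∨-true-right false = refl

∣𝐒∣-full : ∀ {n m} (S : Family n m) → (∀ x → ∃[ v ] lookup (S v) x ≡ true) → ∣ 𝐒 S ∣ ≡ m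
∣𝐒∣-full {m = m} S used = trans (card (𝐒 S))
  (trans (sum-cong-≗ (λ x → let (v , x∈Sv) = used x in 𝟙-true (∈member⇒∈𝐒 S x v x∈Sv)))
         (trans (sum-const {m} 1) (*-identityʳ m)))

-- An enumeration Fin ∣ A ∣ → Fin m of the elements of a subset A: it
-- relabels the used elements of a representation as consecutive indices.

enum : ∀ {m} (A : Subset m) → Fin ∣ A ∣ → Fin m
enum (true ∷ A)  zero    = zero
enum (true ∷ A)  (suc i) = suc (enum A i)
enum (false ∷ A) i       = suc (enum A i)

enum-∈ : ∀ {m} (A : Subset m) i → lookup A (enum A i) ≡ true
enum-∈ (true ∷ A)  zero    = refl
enum-∈ (true ∷ A)  (suc i) = enum-∈ A i
enum-∈ (false ∷ A) i       = enum-∈ A i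

enum-injective : ∀ {m} (A : Subset m) {i j} → enum A i ≡ enum A j → i ≡ j
enum-injective (true ∷ A)  {zero}  {zero}  _  = refl
enum-injective (true ∷ A)  {suc i} {suc j} eq = cong suc (enum-injective A (fsuc-injective eq))
enum-injective (false ∷ A)                 eq = enum-injective A (fsuc-injective eq)

enum-surjective : ∀ {m} (A : Subset m) x → lookup A x ≡ true → ∃[ i ] enum A i ≡ x
enum-surjective (true ∷ A)  zero    _  = zero , refl
enum-surjective (true ∷ A)  (suc x) x∈ with enum-surjective A x x∈
... | i , eq = suc i , cong suc eq
enum-surjective (false ∷ A) (suc x) x∈ with enum-surjective A x x∈
... | i , eq = i , cong suc eq

sum-enum : ∀ {m} (A : Subset m) (f : Fin m → ℕ) →
           sum (λ i → f (enum A i)) ≡ sum (λ x → 𝟙 (lookup A x) * f x)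
sum-enum []          f = refl
sum-enum (true ∷ A)  f = cong₂ _+_ (sym (+-identityʳ (f zero))) (sum-enum A (λ x → f (suc x)))
sum-enum (false ∷ A) f = sum-enum A (λ x → f (suc x))

extend : ∀ {n} → (Fin n → Bool) → Bool → Fin (suc n) → Bool
extend {zero}  h b zero    = b
extend {suc n} h b zero    = h zero
extend {suc n} h b (suc i) = extend (λ j → h (suc j)) b i

extend-inject₁ : ∀ {n} (h : Fin n → Bool) b i → extend h b (inject₁ i) ≡ h i
extend-inject₁ {suc n} h b zero    = refl
extend-inject₁ {suc n} h b (suc i) = extend-inject₁ (λ j → h (suc j)) b i

extend-fromℕ : ∀ {n} (h : Fin n → Bool) b → extend h b (fromℕ n) ≡ b
extend-fromℕ {zero}  h b = refl
extend-fromℕ {suc n} h b = extend-fromℕ (λ j → h (suc j)) b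

old-or-new : ∀ {n} (j : Fin (suc n)) → (∃[ i ] j ≡ inject₁ i) ⊎ j ≡ fromℕ n
old-or-new {zero}  zero    = inj₂ refl
old-or-new {suc n} zero    = inj₁ (zero , refl)
old-or-new {suc n} (suc j) with old-or-new j
... | inj₁ (i , j≡i) = inj₁ (suc i , cong suc j≡i)
... | inj₂ j≡new     = inj₂ (cong suc j≡new)

another-element : ∀ {m} (A : Subset m) {a} → 2 ≤ ∣ A ∣ → lookup A a ≡ true →
                  ∃[ b ] (b ≢ a × lookup A b ≡ true)
another-element {m} A {a} 2≤∣A∣ a∈A
  with positive-term (without a f)
         (+-cancelˡ-≤ 1 1 _ (≤-trans (subst (2 ≤_) (card A) 2≤∣A∣)
           (≤-reflexive (trans (sum-without a f) (cong (_+ sum (without a f)) (𝟙-true a∈A))))))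
  where
  f : Fin m → ℕ
  f x = 𝟙 (lookup A x)
... | b , pos with without-pos (λ x → 𝟙 (lookup A x)) pos
...   | b≢a , b∈A = b , b≢a , 𝟙-pos b∈A

-- The counting identity s + n = s² + c of a uniform representation, with
-- s = r + 1, read off as n = r² + r + c.
square-identity : ∀ r n c → suc r + n ≡ suc r * suc r + c → n ≡ r * r + r + c
square-identity r n c eq = +-cancelˡ-≡ (suc r) n _ (trans eq (expand r c))
  where
  expand : ∀ r c → suc r * suc r + c ≡ suc r + (r * r + r + c)
  expand = solve-∀

-- The numbers r² + r + 1 and k² + k are never equal (k² + k is strictly
-- increasing in k and r² + r + 1 lies strictly between consecutive values).
projective≢affine : ∀ r k → r * r + r + 1 ≢ k * k + k
projective≢affine r k eq with k ≤? r
... | yes k≤r = <-irrefl (sym eq)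
      (subst (suc (k * k + k) ≤_) (+-comm 1 (r * r + r)) (s≤s (+-mono-≤ (*-mono-≤ k≤r k≤r) k≤r)))
... | no k≰r = <-irrefl eq (≤-trans (subst (suc (r * r + r + 1) ≤_) (sym (expand r)) (m≤m+n _ (r + r)))
                                    (+-mono-≤ (*-mono-≤ r<k r<k) r<k))
  where
  r<k : suc r ≤ k
  r<k = ≰⇒> k≰r
  expand : ∀ r → suc r * suc r + suc r ≡ suc (r * r + r + 1) + (r + r)
  expand = solve-∀

deficiency-one : ∀ n c s → 2 ≤ n → 1 ≤ c → n * c + s ≤ s * s → c + (s + n) ≡ s * s + 1 → c ≡ 1
deficiency-one n (suc zero)    s _   _ _ _ = refl
deficiency-one n (suc (suc k)) s 2≤n _ bound eq = ⊥-elim (<⇒≱ small large)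
  where
  large : n * suc (suc k) + (s + 1) ≤ suc (suc k) + (s + n)
  large = subst (n * suc (suc k) + (s + 1) ≤_) (sym eq)
            (subst (_≤ s * s + 1) (+-assoc (n * suc (suc k)) s 1) (+-monoˡ-≤ 1 bound))
  doubled : 2 + k ≤ n * suc k
  doubled = ≤-trans (subst (2 + k ≤_) (sym (twice k)) (m≤m+n (2 + k) k)) (*-monoˡ-≤ (suc k) 2≤n)
    where
    twice : ∀ k → 2 * suc k ≡ 2 + k + k
    twice = solve-∀
  small : suc (suc k) + (s + n) < n * suc (suc k) + (s + 1)
  small = subst₂ _≤_ (sym (lhs k s n)) (sym (rhs k s n)) (+-monoˡ-≤ (s + n + 1) doubled)
    where
    lhs : ∀ k s n → suc (suc (suc k) + (s + n)) ≡ (2 + k) + (s + n + 1)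
    lhs = solve-∀
    rhs : ∀ k s n → n * suc (suc k) + (s + 1) ≡ n * suc k + (s + n + 1)
    rhs = solve-∀

order≥2 : ∀ r c → c ≤ 1 → 4 ≤ r * r + r + c → 2 ≤ r
order≥2 zero             c c≤1 4≤c = ⊥-elim (<⇒≱ (s≤s c≤1) (≤-trans (s≤s (s≤s z≤n)) 4≤c))
order≥2 (suc zero)       c c≤1 (s≤s (s≤s 2≤c)) = ⊥-elim (<⇒≱ (s≤s c≤1) 2≤c)
order≥2 (suc (suc r))    _ _ _ = s≤s (s≤s z≤n)

three≡r²+r+1 : ∀ r → 3 ≡ r * r + r + 1 → r ≡ 1
three≡r²+r+1 zero          ()
three≡r²+r+1 (suc zero)    _  = refl
three≡r²+r+1 (suc (suc r)) eq = ⊥-elim (<-irrefl eq 3<)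
  where
  3< : suc 3 ≤ suc (suc r) * suc (suc r) + suc (suc r) + 1
  3< = ≤-trans (*-mono-≤ {2} {suc (suc r)} 2≤ 2≤) (≤-trans (m≤m+n _ (suc (suc r))) (m≤m+n _ 1))
    where
    2≤ : 2 ≤ suc (suc r)
    2≤ = s≤s (s≤s z≤n)

n≤n*n : ∀ k → k ≤ k * k
n≤n*n zero    = z≤n
n≤n*n (suc k) = m≤m*n (suc k) (suc k)

k≡k*k⇒k≤1 : ∀ k → k ≡ k * k → k ≤ 1
k≡k*k⇒k≤1 zero          _  = z≤n
k≡k*k⇒k≤1 (suc zero)    _  = s≤s z≤n
k≡k*k⇒k≤1 (suc (suc k)) eq = ⊥-elim (<-irrefl eq (m<m*n (suc (suc k)) (suc (suc k)) (s≤s (s≤s z≤n))))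

two-indices : ∀ {k} → 2 ≤ k → Σ (Fin k) λ a → Σ (Fin k) λ b → b ≢ a
two-indices {suc zero}    (s≤s ())
two-indices {suc (suc k)} _ = zero , suc zero , λ ()

two-points-avoiding : ∀ {p} (L : Subset p) → 3 ≤ ∣ L ∣ → (q : Fin p) →
  ∃[ a ] ∃[ b ] (b ≢ a × a ≢ q × b ≢ q × lookup L a ≡ true × lookup L b ≡ true)
two-points-avoiding {p} L 3≤∣L∣ q
  with two-positive-terms (without q f) (λ x → ≤-trans (without-≤ q x f) (𝟙≤1 (lookup L x)))
         (+-cancelˡ-≤ 1 2 _ (≤-trans (subst (3 ≤_) (card L) 3≤∣L∣)
                                     (sum≤1+sum-without q f (λ x → 𝟙≤1 (lookup L x)))))
  where
  f : Fin p → ℕ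
  f x = 𝟙 (lookup L x)
... | a , b , b≢a , a-pos , b-pos
  with without-pos (λ x → 𝟙 (lookup L x)) a-pos | without-pos (λ x → 𝟙 (lookup L x)) b-pos
...   | a≢q , a∈L | b≢q , b∈L = a , b , b≢a , a≢q , b≢q , 𝟙-pos a∈L , 𝟙-pos b∈L

-- The incidence axioms in their combinatorial form (two points span
-- exactly one line, two lines meet, lines have ≥ 3 points, ≥ 2 lines)
-- already yield a projective plane: the non-degeneracy (four points in
-- general position) is derived by taking two points off the intersection
-- q on each of two lines.
module FromIncidence {p l : ℕ} (line : Fin l → Subset p)
  (joined-once : ∀ {a b i j} → b ≢ a → lookup (line i) a ≡ true → lookup (line i) b ≡ true →
                 lookup (line j) a ≡ true → lookup (line j) b ≡ true → i ≡ j)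
  (joined : ∀ a b → b ≢ a → ∃[ i ] (lookup (line i) a ≡ true × lookup (line i) b ≡ true))
  (meet : ∀ i j → j ≢ i → ∃[ x ] (lookup (line i) x ≡ true × lookup (line j) x ≡ true))
  (thick : ∀ i → 3 ≤ ∣ line i ∣)
  (two-lines : 2 ≤ l) where

  private
    on : Fin l → Fin p → Set
    on i x = lookup (line i) x ≡ true

  line-injective : ∀ {i j} → line i ≡ line j → i ≡ j
  line-injective {i} eq
    with two-positive-terms (λ x → 𝟙 (lookup (line i) x)) (λ x → 𝟙≤1 (lookup (line i) x))
           (subst (2 ≤_) (card (line i)) (≤-trans (s≤s (s≤s z≤n)) (thick i)))
  ... | a , b , b≢a , a∈ , b∈ = joined-once b≢a (𝟙-pos a∈) (𝟙-pos b∈)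
          (subst (λ L → lookup L a ≡ true) eq (𝟙-pos a∈)) (subst (λ L → lookup L b ≡ true) eq (𝟙-pos b∈))

  private
    i₀ i₁ : Fin l
    i₀ = proj₁ (two-indices two-lines)
    i₁ = proj₁ (proj₂ (two-indices two-lines))

    i₁≢i₀ : i₁ ≢ i₀
    i₁≢i₀ = proj₂ (proj₂ (two-indices two-lines))

    q : Fin p
    q = proj₁ (meet i₀ i₁ i₁≢i₀)

    q∈₀ : on i₀ q
    q∈₀ = proj₁ (proj₂ (meet i₀ i₁ i₁≢i₀))

    q∈₁ : on i₁ q
    q∈₁ = proj₂ (proj₂ (meet i₀ i₁ i₁≢i₀))

    off-q : ∀ {z} → z ≢ q → on i₀ z → ¬ on i₁ z
    off-q z≢q z∈₀ z∈₁ = i₁≢i₀ (sym (joined-once z≢q q∈₀ z∈₀ q∈₁ z∈₁))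

    general-position : ∃[ a ] ∃[ b ] ∃[ c ] ∃[ d ]
      (a ≢ b × a ≢ c × a ≢ d × b ≢ c × b ≢ d × c ≢ d ×
       ¬ (∃[ i ] (a ∈ line i × b ∈ line i × c ∈ line i)) ×
       ¬ (∃[ i ] (a ∈ line i × b ∈ line i × d ∈ line i)) ×
       ¬ (∃[ i ] (a ∈ line i × c ∈ line i × d ∈ line i)) ×
       ¬ (∃[ i ] (b ∈ line i × c ∈ line i × d ∈ line i)))
    general-position with two-points-avoiding (line i₀) (thick i₀) q
                        | two-points-avoiding (line i₁) (thick i₁) q
    ... | a , b , b≢a , a≢q , b≢q , a∈₀ , b∈₀ | c , d , d≢c , c≢q , d≢q , c∈₁ , d∈₁ =
      a , b , c , d , ≢-sym b≢a , apart a≢q a∈₀ c∈₁ , apart a≢q a∈₀ d∈₁ ,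
      apart b≢q b∈₀ c∈₁ , apart b≢q b∈₀ d∈₁ , ≢-sym d≢c ,
      not-with-ab c≢q c∈₁ , not-with-ab d≢q d∈₁ , not-with-cd a≢q a∈₀ , not-with-cd b≢q b∈₀
      where
      apart : ∀ {x y} → x ≢ q → on i₀ x → on i₁ y → x ≢ y
      apart x≢q x∈₀ y∈₁ refl = off-q x≢q x∈₀ y∈₁
      -- the only line through a and b is i₀, which misses z
      not-with-ab : ∀ {z} → z ≢ q → on i₁ z → ¬ (∃[ i ] (a ∈ line i × b ∈ line i × z ∈ line i))
      not-with-ab z≢q z∈₁ (i , a∈ , b∈ , z∈)
        with joined-once b≢a a∈₀ b∈₀ (∈⇒lookup a∈) (∈⇒lookup b∈)
      ... | refl = off-q z≢q (∈⇒lookup z∈) z∈₁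
      -- the only line through c and d is i₁, which misses z
      not-with-cd : ∀ {z} → z ≢ q → on i₀ z → ¬ (∃[ i ] (z ∈ line i × c ∈ line i × d ∈ line i))
      not-with-cd z≢q z∈₀ (i , z∈ , c∈ , d∈)
        with joined-once d≢c c∈₁ d∈₁ (∈⇒lookup c∈) (∈⇒lookup d∈)
      ... | refl = off-q z≢q z∈₀ (∈⇒lookup z∈)

  plane : ProjectivePlane p l
  plane = record
    { line          = line
    ; line-distinct = line-injective
    ; line-size     = λ i → ≤-trans (s≤s (s≤s z≤n)) (thick i)
    ; two-points    = λ x y x≢y → let (i , x∈ , y∈) = joined x y (≢-sym x≢y) in
                        i , lookup⇒∈ x∈ , lookup⇒∈ y∈ ,
                        (λ j x∈j y∈j → joined-once (≢-sym x≢y) (∈⇒lookup x∈j) (∈⇒lookup y∈j) x∈ y∈)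
    ; two-lines     = λ i j i≢j → let (x , x∈i , x∈j) = meet i j (≢-sym i≢j) in
                        x , lookup⇒∈ x∈i , lookup⇒∈ x∈j
    ; four-points   = general-position
    }

-- Counting in a uniform representation S of K_n (n ≥ 2, witnessed by the
-- distinct vertices v₀, v₁) with sets of size s.
module Counting {n m : ℕ} (S : Family n m) (U : IsUniformRepresentation (K n) S)
                (v₀ v₁ : Fin n) (v₁≢v₀ : v₁ ≢ v₀) where

  s : ℕ
  s = ∣ S v₀ ∣

  inc : Fin n → Fin m → Bool
  inc v x = lookup (S v) x

  size : ∀ v → sum (λ x → 𝟙 (inc v x)) ≡ s
  size v = trans (sym (card (S v))) (proj₂ (proj₂ U) v v₀)

  shared : Fin n → Fin n → ℕ
  shared u v = sum (λ x → 𝟙 (inc u x) * 𝟙 (inc v x))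

  shared≡1 : ∀ {u v} → u ≢ v → shared u v ≡ 1
  shared≡1 {u} {v} u≢v = trans (sym (card-∩ (S u) (S v))) (proj₁ (proj₂ (proj₁ U) u v u≢v) u≢v)

  shared-self : ∀ v → shared v v ≡ s
  shared-self v = trans (sum-cong-≗ (λ x → 𝟙-idem (inc v x))) (size v)

  S-injective : ∀ {u v} → S u ≡ S v → u ≡ v
  S-injective = proj₁ (proj₂ U)

  n≥2 : 2 ≤ n
  n≥2 = at-least-two v₀ v₁ v₁≢v₀
    where
    at-least-two : ∀ {k} (a b : Fin k) → b ≢ a → 2 ≤ k
    at-least-two {suc zero}    zero zero b≢a = ⊥-elim (b≢a refl)
    at-least-two {suc (suc k)} _    _    _   = s≤s (s≤s z≤n)

  n≥1 : 1 ≤ n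
  n≥1 = ≤-trans (s≤s z≤n) n≥2

  s≥1 : 1 ≤ s
  s≥1 = begin
    1                         ≡⟨ sym (shared≡1 (≢-sym v₁≢v₀)) ⟩
    shared v₀ v₁              ≤⟨ sum-mono (λ x → ≤-trans (*-monoʳ-≤ (𝟙 (inc v₀ x)) (𝟙≤1 (inc v₁ x)))
                                                         (≤-reflexive (*-identityʳ _))) ⟩
    sum (λ x → 𝟙 (inc v₀ x))  ≡⟨ size v₀ ⟩
    s                         ∎
    where open ≤-Reasoning

  common-set-unique : ∀ {x y a b} → y ≢ x → inc a x ≡ true → inc a y ≡ true →
                      inc b x ≡ true → inc b y ≡ true → a ≡ b
  common-set-unique {x} {y} {a} {b} y≢x a∋x a∋y b∋x b∋y with a ≟ᶠ b
  ... | yes a≡b = a≡b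
  ... | no a≢b  = ⊥-elim (1+n≰n (subst (2 ≤_) (shared≡1 a≢b)
          (subst (_≤ shared a b) (cong₂ _+_ (cong₂ _*_ (𝟙-true a∋x) (𝟙-true b∋x))
                                             (cong₂ _*_ (𝟙-true a∋y) (𝟙-true b∋y)))
                 (two-terms≤sum (λ z → 𝟙 (inc a z) * 𝟙 (inc b z)) y≢x))))

  together≤1 : ∀ {x z} → z ≢ x → sum (λ w → 𝟙 (inc w x) * 𝟙 (inc w z)) ≤ 1
  together≤1 {x} {z} z≢x = subst (_≤ 1) (sum-cong-≗ (λ w → 𝟙-∧ (inc w x) (inc w z)))
                             (count≤1 (λ w → inc w x ∧ inc w z) both)
    where
    both : ∀ {a b} → (inc a x ∧ inc a z) ≡ true → (inc b x ∧ inc b z) ≡ true → a ≡ b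
    both a∋ b∋ with ∧-true a∋ | ∧-true b∋
    ... | a∋x , a∋z | b∋x , b∋z = common-set-unique z≢x a∋x a∋z b∋x b∋z

  common-element : ∀ {a b} → a ≢ b → ∃[ x ] (inc a x ≡ true × inc b x ≡ true)
  common-element a≢b with positive-term _ (≤-reflexive (sym (shared≡1 a≢b)))
  ... | x , pos = x , 𝟙*𝟙-pos pos

  common-element-unique : ∀ {a b} → a ≢ b → ∀ {x y} → inc a x ≡ true → inc b x ≡ true →
                          inc a y ≡ true → inc b y ≡ true → x ≡ y
  common-element-unique a≢b a∋x b∋x a∋y b∋y = sum≡1-unique _ (shared≡1 a≢b)
    (≤-reflexive (sym (cong₂ _*_ (𝟙-true a∋x) (𝟙-true b∋x))))
    (≤-reflexive (sym (cong₂ _*_ (𝟙-true a∋y) (𝟙-true b∋y))))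

  used : Fin m → Bool
  used x = lookup (𝐒 S) x

  V : ℕ
  V = sum (λ x → 𝟙 (used x))

  ∣𝐒∣≡V : ∣ 𝐒 S ∣ ≡ V
  ∣𝐒∣≡V = card (𝐒 S)

  used-if-in : ∀ {x} v → inc v x ≡ true → used x ≡ true
  used-if-in {x} v = ∈member⇒∈𝐒 S x v

  deg : Fin m → ℕ
  deg x = sum (λ v → 𝟙 (inc v x))

  deg-unused : ∀ {x} → used x ≡ false → deg x ≡ 0
  deg-unused {x} unused = trans (sum-cong-≗ not-in) (sum-zero {n})
    where
    not-in : ∀ v → 𝟙 (inc v x) ≡ 0
    not-in v with inc v x in v∋x
    ... | true  = ⊥-elim (false≢true (trans (sym unused) (used-if-in v v∋x)))
    ... | false = refl

  deg-used : ∀ {x} → used x ≡ true → 1 ≤ deg x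
  deg-used {x} x-used with ∈𝐒⇒∈member S x x-used
  ... | v , v∋x = ≤-trans (≤-reflexive (sym (𝟙-true v∋x))) (term≤sum v (λ w → 𝟙 (inc w x)))

  used-inc : ∀ v x → 𝟙 (used x) * 𝟙 (inc v x) ≡ 𝟙 (inc v x)
  used-inc v x with inc v x in v∋x
  ... | false = *-zeroʳ (𝟙 (used x))
  ... | true rewrite used-if-in v v∋x = refl

  used-deg : ∀ x → 𝟙 (used x) * deg x ≡ deg x
  used-deg x with used x in x-used
  ... | true  = +-identityʳ (deg x)
  ... | false = sym (deg-unused x-used)

  -- double counting of incidences
  sum-deg : sum deg ≡ n * s
  sum-deg = trans (sym (∑-comm (λ v x → 𝟙 (inc v x)))) (trans (sum-cong-≗ size) (sum-const {n} s))

  -- Σ_w |S_v ∩ S_w| = s + (n - 1): S_v meets itself in s elements, the others in one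
  sum-shared : ∀ v → sum (shared v) + 1 ≡ s + n
  sum-shared v = begin
    sum (shared v) + 1                          ≡⟨ cong (_+ 1) (sum-without v (shared v)) ⟩
    shared v v + sum (without v (shared v)) + 1 ≡⟨ cong (λ z → z + sum (without v (shared v)) + 1) (shared-self v) ⟩
    s + sum (without v (shared v)) + 1          ≡⟨ +-assoc s _ 1 ⟩
    s + (sum (without v (shared v)) + 1)        ≡⟨ cong (λ z → s + (z + 1)) (sum-cong-≗ others) ⟩
    s + (sum (without v (λ _ → 1)) + 1)         ≡⟨ cong (s +_) (+-comm _ 1) ⟩
    s + (1 + sum (without v (λ _ → 1)))         ≡⟨ cong (s +_) (sym (sum-without v (λ _ → 1))) ⟩
    s + sum {n} (λ _ → 1)                       ≡⟨ cong (s +_) (trans (sum-const {n} 1) (*-identityʳ n)) ⟩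
    s + n                                       ∎
    where
    open ≡-Reasoning
    others : ∀ w → without v (shared v) w ≡ without v (λ _ → 1) w
    others w with w ≟ᶠ v
    ... | yes _  = refl
    ... | no w≢v = shared≡1 (≢-sym w≢v)

  sum-deg-along : ∀ v → sum (λ x → 𝟙 (inc v x) * deg x) + 1 ≡ s + n
  sum-deg-along v = trans (cong (_+ 1) (sum-factor-swap (λ x → 𝟙 (inc v x)) (λ x w → 𝟙 (inc w x))))
                          (sum-shared v)

  star-or-not : (Σ (Fin m) λ c → ∀ v → inc v c ≡ true) ⊎ (∀ x → ∃[ w ] inc w x ≡ false)
  star-or-not with any? (λ x → all? (λ v → inc v x ≟ᵇ true))
  ... | yes (c , in-all) = inj₁ (c , in-all)
  ... | no no-star       = inj₂ (λ x →
          let (w , w∌x) = ¬∀⟶∃¬ n (λ v → inc v x ≡ true) (λ v → inc v x ≟ᵇ true) (λ all → no-star (x , all))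
          in w , not-true w∌x)
    where
    not-true : ∀ {b} → ¬ b ≡ true → b ≡ false
    not-true {true}  b≢true = ⊥-elim (b≢true refl)
    not-true {false} _      = refl

  -- An element of every set: then the sets are disjoint apart from c.
  module Star (c : Fin m) (in-all : ∀ v → inc v c ≡ true) where

    deg-c : deg c ≡ n
    deg-c = trans (sum-cong-≗ (λ v → 𝟙-true (in-all v))) (trans (sum-const {n} 1) (*-identityʳ n))

    deg≤1 : ∀ {x} → x ≢ c → deg x ≤ 1
    deg≤1 x≢c = count≤1 _ (λ a∋x b∋x → common-set-unique x≢c (in-all _) a∋x (in-all _) b∋x)

    used≡deg : ∀ {x} → x ≢ c → 𝟙 (used x) ≡ deg x
    used≡deg {x} x≢c with used x in x-used
    ... | false = sym (deg-unused x-used)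
    ... | true  = ≤-antisym (deg-used x-used) (deg≤1 x≢c)

    V+n : V + n ≡ 1 + n * s
    V+n = begin
      V + n                                           ≡⟨ cong (_+ n) (sum-without c (λ x → 𝟙 (used x))) ⟩
      𝟙 (used c) + sum (without c (λ x → 𝟙 (used x))) + n
                                                      ≡⟨ cong (λ b → 𝟙 b + sum (without c (λ x → 𝟙 (used x))) + n) (used-if-in v₀ (in-all v₀)) ⟩
      1 + sum (without c (λ x → 𝟙 (used x))) + n      ≡⟨ +-assoc 1 _ n ⟩
      1 + (sum (without c (λ x → 𝟙 (used x))) + n)    ≡⟨ cong (λ z → 1 + (z + n)) (sum-cong-≗ off-c) ⟩
      1 + (sum (without c deg) + n)                   ≡⟨ cong (1 +_) (+-comm _ n) ⟩
      1 + (n + sum (without c deg))                   ≡⟨ cong (λ z → 1 + (z + sum (without c deg))) (sym deg-c) ⟩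
      1 + (deg c + sum (without c deg))               ≡⟨ cong (1 +_) (sym (sum-without c deg)) ⟩
      1 + sum deg                                     ≡⟨ cong (1 +_) sum-deg ⟩
      1 + n * s                                       ∎
      where
      open ≡-Reasoning
      off-c : ∀ x → without c (λ x → 𝟙 (used x)) x ≡ without c deg x
      off-c x with x ≟ᶠ c
      ... | yes _   = refl
      ... | no x≢c  = used≡deg x≢c

    -- sets of size one would all equal {c}
    s≥2 : 2 ≤ s
    s≥2 with 2 ≤? s
    ... | yes 2≤s = 2≤s
    ... | no 2≰s  = ⊥-elim (v₁≢v₀ (S-injective (trans (singleton v₁) (sym (singleton v₀)))))
      where
      singleton : ∀ v → S v ≡ ⁅ c ⁆
      singleton v = subset-ext (S v) ⁅ c ⁆ entry
        where
        entry : ∀ y → inc v y ≡ lookup ⁅ c ⁆ y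
        entry y rewrite lookup-⁅⁆ c y with y ≟ᶠ c
        ... | yes refl = in-all v
        ... | no y≢c with inc v y in v∋y
        ...   | false = refl
        ...   | true  = ⊥-elim (2≰s (subst (2 ≤_) (size v)
                  (subst (_≤ sum (λ x → 𝟙 (inc v x))) (cong₂ _+_ (𝟙-true (in-all v)) (𝟙-true v∋y))
                         (two-terms≤sum (λ x → 𝟙 (inc v x)) y≢c))))

    V>n : suc n ≤ V
    V>n = +-cancelʳ-≤ n (suc n) V (subst (suc n + n ≤_) (sym V+n) (s≤s n+n≤n*s))
      where
      n+n≤n*s : n + n ≤ n * s
      n+n≤n*s = subst (_≤ n * s) (trans (*-comm n 2) (cong (n +_) (+-identityʳ n))) (*-monoʳ-≤ n s≥2)

    V≡n+1⇒s≡2 : V ≡ suc n → s ≡ 2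
    V≡n+1⇒s≡2 V≡n+1 = *-cancelˡ-≡ s 2 n {{≢-nonZero (λ n≡0 → 1+n≰n (subst (1 ≤_) n≡0 n≥1))}}
      (+-cancelˡ-≡ 1 _ _ (trans (sym V+n) (trans (cong (_+ n) V≡n+1)
        (cong (1 +_) (trans (cong (n +_) (sym (+-identityʳ n))) (*-comm 2 n))))))

    typeN : s ≡ 2 → TypeN S
    typeN s≡2 = c , partner , partner-injective , partner≢c ,
                λ v → two-element-set (S v) (trans (card (S v)) (trans (size v) s≡2))
                        (partner≢c v) (in-all v) (partner∈ v)
      where
      other : ∀ v → ∃[ x ] (x ≢ c × inc v x ≡ true)
      other v = another-element (S v) (≤-reflexive (sym (trans (card (S v)) (trans (size v) s≡2)))) (in-all v)
      partner : Fin n → Fin m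
      partner v = proj₁ (other v)
      partner≢c : ∀ v → partner v ≢ c
      partner≢c v = proj₁ (proj₂ (other v))
      partner∈ : ∀ v → inc v (partner v) ≡ true
      partner∈ v = proj₂ (proj₂ (other v))
      partner-injective : ∀ {a b} → partner a ≡ partner b → a ≡ b
      partner-injective {a} {b} eq = common-set-unique (partner≢c a) (in-all a) (partner∈ a)
        (in-all b) (subst (λ z → inc b z ≡ true) (sym eq) (partner∈ b))

  -- No element lies in every set.  Then each element has degree at most s
  -- and the deficiencies s - deg x are governed by two counting identities.
  module NoStar (misses : ∀ x → ∃[ w ] inc w x ≡ false) where

    -- the sets through x meet a set S_w missing x in pairwise distinct elements
    deg≤s : ∀ x → deg x ≤ s
    deg≤s x = begin
      deg x                                                         ≡⟨ sum-cong-≗ meets-w ⟩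
      sum (λ a → 𝟙 (inc a x) * shared a w)                          ≡⟨ sum-factor-swap (λ a → 𝟙 (inc a x)) (λ a y → 𝟙 (inc a y) * 𝟙 (inc w y)) ⟩
      sum (λ y → sum (λ a → 𝟙 (inc a x) * (𝟙 (inc a y) * 𝟙 (inc w y)))) ≤⟨ sum-mono at-most-one ⟩
      sum (λ y → 𝟙 (inc w y))                                       ≡⟨ size w ⟩
      s                                                             ∎
      where
      open ≤-Reasoning
      w : Fin n
      w = proj₁ (misses x)
      w∌x : inc w x ≡ false
      w∌x = proj₂ (misses x)
      meets-w : ∀ a → 𝟙 (inc a x) ≡ 𝟙 (inc a x) * shared a w
      meets-w a with inc a x in a∋x
      ... | false = refl
      ... | true  = sym (trans (+-identityʳ _) (shared≡1 a≢w))
        where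
        a≢w : a ≢ w
        a≢w refl = false≢true (trans (sym w∌x) a∋x)
      at-most-one : ∀ y → sum (λ a → 𝟙 (inc a x) * (𝟙 (inc a y) * 𝟙 (inc w y))) ≤ 𝟙 (inc w y)
      at-most-one y with inc w y in w∋y
      ... | false = ≤-reflexive (trans (sum-cong-≗ (λ a → trans (cong (𝟙 (inc a x) *_) (*-zeroʳ (𝟙 (inc a y))))
                                                                (*-zeroʳ (𝟙 (inc a x)))))
                                       (sum-zero {n}))
      ... | true  = subst (_≤ 1) (sum-cong-≗ (λ a → cong (𝟙 (inc a x) *_) (sym (*-identityʳ _))))
                      (together≤1 y≢x)
        where
        y≢x : y ≢ x
        y≢x refl = false≢true (trans (sym w∌x) w∋y)

    e : Fin m → ℕ
    e x = s ∸ deg x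

    deg+e : ∀ x → deg x + e x ≡ s
    deg+e x = m+[n∸m]≡n (deg≤s x)

    defect : Fin n → ℕ
    defect v = sum (λ x → 𝟙 (inc v x) * e x)

    -- counting the pairs (x, w) with x ∈ S_v ∩ S_w shows defect v = s² + 1 - s - n
    defect-identity : ∀ v → defect v + (s + n) ≡ s * s + 1
    defect-identity v = begin
      defect v + (s + n)                                  ≡⟨ cong (defect v +_) (sym (sum-deg-along v)) ⟩
      defect v + (sum (λ x → 𝟙 (inc v x) * deg x) + 1)   ≡⟨ sym (+-assoc (defect v) _ 1) ⟩
      defect v + sum (λ x → 𝟙 (inc v x) * deg x) + 1     ≡⟨ cong (_+ 1) (sym (∑-distrib-+ (λ x → 𝟙 (inc v x) * e x) (λ x → 𝟙 (inc v x) * deg x))) ⟩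
      sum (λ x → 𝟙 (inc v x) * e x + 𝟙 (inc v x) * deg x) + 1
                                                          ≡⟨ cong (_+ 1) (sum-cong-≗ (λ x → trans (sym (*-distribˡ-+ (𝟙 (inc v x)) (e x) (deg x)))
                                                                (trans (cong (𝟙 (inc v x) *_) (trans (+-comm (e x) (deg x)) (deg+e x)))
                                                                       (*-comm (𝟙 (inc v x)) s)))) ⟩
      sum (λ x → s * 𝟙 (inc v x)) + 1                     ≡⟨ cong (_+ 1) (trans (sym (*-distribˡ-sum s (λ x → 𝟙 (inc v x)))) (cong (s *_) (size v))) ⟩
      s * s + 1                                           ∎
      where open ≡-Reasoning

    c : ℕ
    c = defect v₀

    defect≡c : ∀ v → defect v ≡ c
    defect≡c v = +-cancelʳ-≡ (s + n) (defect v) c (trans (defect-identity v) (sym (defect-identity v₀)))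

    -- Q = Σ deg · e = Σ_v defect v = n c
    Q : ℕ
    Q = sum (λ x → deg x * e x)

    Q≡n*c : Q ≡ n * c
    Q≡n*c = begin
      sum (λ x → deg x * e x)                          ≡⟨ sum-cong-≗ (λ x → *-comm (deg x) (e x)) ⟩
      sum (λ x → e x * deg x)                          ≡⟨ sum-factor-swap e (λ x v → 𝟙 (inc v x)) ⟩
      sum (λ v → sum (λ x → e x * 𝟙 (inc v x)))        ≡⟨ sum-cong-≗ (λ v → sum-cong-≗ (λ x → *-comm (e x) (𝟙 (inc v x)))) ⟩
      sum defect                                       ≡⟨ sum-cong-≗ defect≡c ⟩
      sum {n} (λ _ → c)                                ≡⟨ sum-const {n} c ⟩
      n * c                                            ∎
      where open ≡-Reasoning

    R : ℕ
    R = sum (λ x → 𝟙 (used x) * e x)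

    R+n*s : R + n * s ≡ s * V
    R+n*s = begin
      R + n * s                                        ≡⟨ cong (R +_) (trans (sym sum-deg) (sum-cong-≗ (λ x → sym (used-deg x)))) ⟩
      R + sum (λ x → 𝟙 (used x) * deg x)               ≡⟨ sym (∑-distrib-+ (λ x → 𝟙 (used x) * e x) (λ x → 𝟙 (used x) * deg x)) ⟩
      sum (λ x → 𝟙 (used x) * e x + 𝟙 (used x) * deg x) ≡⟨ sum-cong-≗ (λ x → trans (sym (*-distribˡ-+ (𝟙 (used x)) (e x) (deg x)))
                                                           (trans (cong (𝟙 (used x) *_) (trans (+-comm (e x) (deg x)) (deg+e x)))
                                                                  (*-comm (𝟙 (used x)) s))) ⟩
      sum (λ x → s * 𝟙 (used x))                       ≡⟨ sym (*-distribˡ-sum s (λ x → 𝟙 (used x))) ⟩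
      s * V                                            ∎
      where open ≡-Reasoning

    V≥n : n ≤ V
    V≥n = *-cancelˡ-≤ s {{≢-nonZero (λ s≡0 → 1+n≰n (subst (1 ≤_) s≡0 s≥1))}}
            (subst (_≤ s * V) (*-comm n s) (subst (n * s ≤_) R+n*s (m≤n+m (n * s) R)))

    -- r = s - 1, the order of the plane to be built
    r : ℕ
    r = s ∸ 1

    s≡1+r : s ≡ suc r
    s≡1+r = sym (m+[n∸m]≡n s≥1)

    used-e : ∀ {x} → used x ≡ true → 𝟙 (used x) * e x ≡ e x
    used-e x-used rewrite x-used = +-identityʳ _

    -- An element x with deg x · r = V - 1 shares a set with every other used
    -- element: the sets through x cover deg x · r further elements, no
    -- element twice, and there are only V - 1 of them.
    meets-every-used : ∀ {x y} → used x ≡ true → used y ≡ true → y ≢ x → deg x * r + 1 ≡ V →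
                       ∃[ w ] (inc w x ≡ true × inc w y ≡ true)
    meets-every-used {x} {y} x-used y-used y≢x full 
      with positive-term (λ w → 𝟙 (inc w x) * 𝟙 (inc w y)) (≤-reflexive (sym together-y))
      where
      together : Fin m → ℕ
      together z = sum (λ w → 𝟙 (inc w x) * 𝟙 (inc w z))

      sum-together : sum together ≡ deg x * s
      sum-together = begin
        sum together                           ≡⟨ sym (sum-factor-swap (λ w → 𝟙 (inc w x)) (λ w z → 𝟙 (inc w z))) ⟩
        sum (λ w → 𝟙 (inc w x) * sum (λ z → 𝟙 (inc w z))) ≡⟨ sum-cong-≗ (λ w → trans (cong (𝟙 (inc w x) *_) (size w))
                                                                                   (*-comm (𝟙 (inc w x)) s)) ⟩
        sum (λ w → s * 𝟙 (inc w x))            ≡⟨ sym (*-distribˡ-sum s (λ w → 𝟙 (inc w x))) ⟩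
        s * deg x                              ≡⟨ *-comm s (deg x) ⟩
        deg x * s                              ∎
        where open ≡-Reasoning

      together-others : sum (without x together) ≡ deg x * r
      together-others = +-cancelˡ-≡ (deg x) _ _ (begin
        deg x + sum (without x together)      ≡⟨ cong (_+ sum (without x together)) (sum-cong-≗ (λ w → sym (𝟙-idem (inc w x)))) ⟩
        together x + sum (without x together) ≡⟨ sym (sum-without x together) ⟩
        sum together                          ≡⟨ sum-together ⟩
        deg x * s                             ≡⟨ cong (deg x *_) s≡1+r ⟩
        deg x * suc r                         ≡⟨ *-suc (deg x) r ⟩
        deg x + deg x * r                     ∎)
        where open ≡-Reasoning

      used-others : sum (without x (λ z → 𝟙 (used z))) + 1 ≡ V
      used-others = trans (+-comm _ 1) (trans (cong (_+ sum (without x (λ z → 𝟙 (used z)))) (sym (𝟙-true x-used)))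
                                              (sym (sum-without x (λ z → 𝟙 (used z)))))

      together≤used : ∀ z → without x together z ≤ without x (λ z → 𝟙 (used z)) z
      together≤used z with z ≟ᶠ x
      ... | yes _ = z≤n
      ... | no z≢x with used z in z-used
      ...   | true  = together≤1 z≢x
      ...   | false = ≤-reflexive (trans (sum-cong-≗ (λ w → trans (cong (𝟙 (inc w x) *_) (𝟙-false (not-in w)))
                                                                (*-zeroʳ (𝟙 (inc w x)))))
                                         (sum-zero {n}))
        where
        not-in : ∀ w → inc w z ≡ false
        not-in w with inc w z in w∋z
        ... | true  = ⊥-elim (false≢true (trans (sym z-used) (used-if-in w w∋z)))
        ... | false = refl

      together-y : together y ≡ 1
      together-y = begin
        together y                              ≡⟨ sym (without-≢ together y≢x) ⟩
        without x together y                    ≡⟨ sum-tight _ _ together≤used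
                                                     (≤-reflexive (+-cancelʳ-≡ 1 _ _
                                                       (trans used-others (trans (sym full)
                                                         (cong (_+ 1) (sym together-others)))))) y ⟩
        without x (λ z → 𝟙 (used z)) y          ≡⟨ without-≢ (λ z → 𝟙 (used z)) y≢x ⟩
        𝟙 (used y)                              ≡⟨ 𝟙-true y-used ⟩
        1                                       ∎
        where open ≡-Reasoning
    ... | w , pos = w , 𝟙*𝟙-pos pos

    -- The used elements, relabelled as Fin ∣ 𝐒 S ∣; they become the lines of
    -- the dual structure whose points are the vertices.
    lab : Fin ∣ 𝐒 S ∣ → Fin m
    lab = enum (𝐒 S)

    lab-used : ∀ i → used (lab i) ≡ true
    lab-used = enum-∈ (𝐒 S)

    label-of : ∀ {v x} → inc v x ≡ true → ∃[ i ] lab i ≡ x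
    label-of {v} {x} v∋x = enum-surjective (𝐒 S) x (used-if-in v v∋x)

    -- A candidate dual: lines indexed by labels, with the vertices embedded
    -- among the points by ι, and vertex v on line i iff lab i ∈ S_v.
    module Dual {p : ℕ} (line : Fin ∣ 𝐒 S ∣ → Subset p) (ι : Fin n → Fin p)
                (on-line : ∀ i v → lookup (line i) (ι v) ≡ inc v (lab i)) where

      private
        through : ∀ {i v} → lookup (line i) (ι v) ≡ true → inc v (lab i) ≡ true
        through {i} {v} v∈i = trans (sym (on-line i v)) v∈i

        at-label : ∀ {i v x} → lab i ≡ x → inc v x ≡ true → lookup (line i) (ι v) ≡ true
        at-label {i} {v} refl v∋x = trans (on-line i v) v∋x

      joined-vertices : ∀ {a b} → b ≢ a → ∃[ i ] (lookup (line i) (ι a) ≡ true × lookup (line i) (ι b) ≡ true)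
      joined-vertices b≢a with common-element (≢-sym b≢a)
      ... | x , a∋x , b∋x with label-of a∋x
      ...   | i , lab-i = i , at-label lab-i a∋x , at-label lab-i b∋x

      joined-vertices-once : ∀ {a b i j} → b ≢ a →
        lookup (line i) (ι a) ≡ true → lookup (line i) (ι b) ≡ true →
        lookup (line j) (ι a) ≡ true → lookup (line j) (ι b) ≡ true → i ≡ j
      joined-vertices-once b≢a a∈i b∈i a∈j b∈j = enum-injective (𝐒 S)
        (common-element-unique (≢-sym b≢a) (through a∈i) (through b∈i) (through a∈j) (through b∈j))

      lines-through-vertex : ∀ v → sum (λ i → 𝟙 (lookup (line i) (ι v))) ≡ s
      lines-through-vertex v = trans (sum-cong-≗ (λ i → cong 𝟙 (on-line i v)))
        (trans (sum-enum (𝐒 S) (λ x → 𝟙 (inc v x))) (trans (sum-cong-≗ (used-inc v)) (size v)))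

      lines-meet : ∀ {i j} → j ≢ i → deg (lab i) * r + 1 ≡ V →
                   ∃[ v ] (lookup (line i) (ι v) ≡ true × lookup (line j) (ι v) ≡ true)
      lines-meet {i} {j} j≢i full
        with meets-every-used (lab-used i) (lab-used j) (λ eq → j≢i (enum-injective (𝐒 S) eq)) full
      ... | v , v∋i , v∋j = v , trans (on-line i v) v∋i , trans (on-line j v) v∋j

      represents : ∀ v x → (x ∈ S v) ⇔ (∃[ i ] (lab i ≡ x × ι v ∈ line i))
      represents v x = mk⇔
        (λ x∈Sv → let (i , lab-i) = label-of (∈⇒lookup x∈Sv) in
                  i , lab-i , lookup⇒∈ (at-label lab-i (∈⇒lookup x∈Sv)))
        (λ { (i , refl , v∈i) → lookup⇒∈ (through (∈⇒lookup v∈i)) })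

    e≤c : ∀ {v x} → inc v x ≡ true → e x ≤ c
    e≤c {v} {x} v∋x = subst (_≤ c) (trans (cong (_* e x) (𝟙-true v∋x)) (+-identityʳ (e x)))
                        (subst (𝟙 (inc v x) * e x ≤_) (defect≡c v) (term≤sum x (λ y → 𝟙 (inc v y) * e y)))

    n≡r²+r+1-c : ∀ {k} → c + k ≡ 1 → n ≡ r * r + r + k
    n≡r²+r+1-c {k} c+k≡1 = square-identity r n k (+-cancelˡ-≡ c _ _ (begin
      c + (suc r + n)             ≡⟨ cong (λ t → c + (t + n)) (sym s≡1+r) ⟩
      c + (s + n)                 ≡⟨ defect-identity v₀ ⟩
      s * s + 1                   ≡⟨ cong (λ t → t * t + 1) s≡1+r ⟩
      suc r * suc r + 1           ≡⟨ cong (suc r * suc r +_) (sym c+k≡1) ⟩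
      suc r * suc r + (c + k)     ≡⟨ +-comm (suc r * suc r) (c + k) ⟩
      c + k + suc r * suc r       ≡⟨ +-assoc c k _ ⟩
      c + (k + suc r * suc r)     ≡⟨ cong (c +_) (+-comm k _) ⟩
      c + (suc r * suc r + k)     ∎))
      where open ≡-Reasoning

    -- an element of full degree s has deg x · r + 1 = r² + r + 1, which will be
    -- V in both cases below, so meets-every-used applies to it
    full-degree : ∀ {x} → deg x ≡ s → deg x * r + 1 ≡ r * r + r + 1
    full-degree deg≡s = trans (cong (λ t → t * r + 1) (trans deg≡s s≡1+r)) (cong (_+ 1) (+-comm r (r * r)))

    s≡r+1 : s ≡ r + 1
    s≡r+1 = trans s≡1+r (+-comm 1 r)

    thick : 2 ≤ r → 3 ≤ s
    thick r≥2 = subst (3 ≤_) (sym s≡1+r) (s≤s r≥2)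

    -- |𝐒 S| = n: no element is deficient, and the sets of vertices through
    -- the elements are the lines of a projective plane of order r.
    module Tight (V≡n : V ≡ n) where

      R≡0 : R ≡ 0
      R≡0 = +-cancelʳ-≡ (n * s) R 0 (trans R+n*s (trans (cong (s *_) V≡n) (*-comm s n)))

      e≡0 : ∀ {x} → used x ≡ true → e x ≡ 0
      e≡0 {x} x-used = trans (sym (used-e x-used)) (sum≡0 _ R≡0 x)

      deg≡s : ∀ {x} → used x ≡ true → deg x ≡ s
      deg≡s {x} x-used = trans (sym (+-identityʳ (deg x))) (trans (cong (deg x +_) (sym (e≡0 x-used))) (deg+e x))

      c≡0 : c ≡ 0
      c≡0 = trans (sum-cong-≗ no-defect) (sum-zero {m})
        where
        no-defect : ∀ x → 𝟙 (inc v₀ x) * e x ≡ 0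
        no-defect x with inc v₀ x in v₀∋x
        ... | false = refl
        ... | true  = trans (+-identityʳ (e x)) (e≡0 (used-if-in v₀ v₀∋x))

      n≡r²+r+1 : n ≡ r * r + r + 1
      n≡r²+r+1 = n≡r²+r+1-c (cong (_+ 1) c≡0)

      module Plane (4≤n : 4 ≤ n) where

        r≥2 : 2 ≤ r
        r≥2 = order≥2 r 1 ≤-refl (subst (4 ≤_) n≡r²+r+1 4≤n)

        line : Fin ∣ 𝐒 S ∣ → Subset n
        line i = tabulate (λ v → inc v (lab i))

        open Dual line (λ v → v) (λ i → lookup∘tabulate (λ v → inc v (lab i)))

        ∣line∣≡s : ∀ i → ∣ line i ∣ ≡ s
        ∣line∣≡s i = trans (card-tabulate (λ v → inc v (lab i))) (deg≡s (lab-used i))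

        plane : ProjectivePlane n ∣ 𝐒 S ∣
        plane = FromIncidence.plane line joined-vertices-once (λ _ _ → joined-vertices)
          (λ i j j≢i → lines-meet j≢i (trans (full-degree (deg≡s (lab-used i))) (trans (sym n≡r²+r+1) (sym V≡n))))
          (λ i → subst (3 ≤_) (sym (∣line∣≡s i)) (thick r≥2))
          (subst (2 ≤_) (sym (trans ∣𝐒∣≡V V≡n)) n≥2)

        order : HasOrder plane r
        order = r≥2 , n≡r²+r+1 , trans ∣𝐒∣≡V (trans V≡n n≡r²+r+1) ,
                (λ i → trans (∣line∣≡s i) s≡r+1) ,
                (λ v → trans (card-tabulate (λ i → lookup (line i) v)) (trans (lines-through-vertex v) s≡r+1))

        typeP : TypeP S
        typeP = r , ∣ 𝐒 S ∣ , plane , order , lab , enum-injective (𝐒 S) , represents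

    -- |𝐒 S| = n + 1: every set contains exactly one deficient element, and
    -- adding a new point on the lines of the deficient elements turns the dual
    -- into a projective plane of order r.
    module OneMore (V≡n+1 : V ≡ suc n) where

      R≡s : R ≡ s
      R≡s = +-cancelʳ-≡ (n * s) R s
        (trans R+n*s (trans (cong (s *_) V≡n+1) (trans (*-suc s n) (cong (s +_) (*-comm s n)))))

      c≥1 : 1 ≤ c
      c≥1 with c in c≡
      ... | suc _ = s≤s z≤n
      ... | zero  = ⊥-elim (1+n≰n (subst (1 ≤_) (trans (sym R≡s) (trans (sum-cong-≗ no-deficiency) (sum-zero {m}))) s≥1))
        where
        no-deficiency : ∀ x → 𝟙 (used x) * e x ≡ 0
        no-deficiency x with used x in x-used
        ... | false = refl
        ... | true with ∈𝐒⇒∈member S x x-used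
        ...   | v , v∋x = trans (+-identityʳ (e x)) (n≤0⇒n≡0 (subst (e x ≤_) c≡ (e≤c v∋x)))

      E₂ : ℕ
      E₂ = sum (λ x → 𝟙 (used x) * (e x * e x))

      Q+E₂ : Q + E₂ ≡ s * R
      Q+E₂ = trans (sym (∑-distrib-+ (λ x → deg x * e x) (λ x → 𝟙 (used x) * (e x * e x))))
               (trans (sum-cong-≗ termwise) (sym (*-distribˡ-sum s (λ x → 𝟙 (used x) * e x))))
        where
        expand : ∀ a b → a * b + (b * b + 0) ≡ (a + b) * (b + 0)
        expand = solve-∀
        termwise : ∀ x → deg x * e x + 𝟙 (used x) * (e x * e x) ≡ s * (𝟙 (used x) * e x)
        termwise x with used x in x-used
        ... | false rewrite deg-unused x-used = sym (*-zeroʳ s)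
        ... | true  = trans (expand (deg x) (e x)) (cong (_* (e x + 0)) (deg+e x))

      R≤E₂ : R ≤ E₂
      R≤E₂ = sum-mono (λ x → *-monoʳ-≤ (𝟙 (used x)) (n≤n*n (e x)))

      c≡1 : c ≡ 1
      c≡1 = deficiency-one n c s n≥2 c≥1 (begin
              n * c + s  ≡⟨ cong₂ _+_ (sym Q≡n*c) (sym R≡s) ⟩
              Q + R      ≤⟨ +-monoʳ-≤ Q R≤E₂ ⟩
              Q + E₂     ≡⟨ Q+E₂ ⟩
              s * R      ≡⟨ cong (s *_) R≡s ⟩
              s * s      ∎)
              (defect-identity v₀)
        where open ≤-Reasoning

      n≡r²+r : n ≡ r * r + r + 0
      n≡r²+r = n≡r²+r+1-c (cong (_+ 0) c≡1)

      s+n≡s*s : s + n ≡ s * s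
      s+n≡s*s = +-cancelˡ-≡ 1 _ _ (trans (cong (_+ (s + n)) (sym c≡1))
                                        (trans (defect-identity v₀) (+-comm (s * s) 1)))

      E₂≡R : E₂ ≡ R
      E₂≡R = +-cancelˡ-≡ n E₂ R (begin
        n + E₂      ≡⟨ cong (_+ E₂) (sym (trans Q≡n*c (trans (cong (n *_) c≡1) (*-identityʳ n)))) ⟩
        Q + E₂      ≡⟨ Q+E₂ ⟩
        s * R       ≡⟨ cong (s *_) R≡s ⟩
        s * s       ≡⟨ sym s+n≡s*s ⟩
        s + n       ≡⟨ +-comm s n ⟩
        n + s       ≡⟨ cong (n +_) (sym R≡s) ⟩
        n + R       ∎)
        where open ≡-Reasoning

      -- R = E₂ with e ≤ e² termwise forces e = e², i.e. every deficiency is 0 or 1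
      e≤1 : ∀ {x} → used x ≡ true → e x ≤ 1
      e≤1 {x} x-used = k≡k*k⇒k≤1 (e x) (begin
        e x                       ≡⟨ sym (used-e x-used) ⟩
        𝟙 (used x) * e x          ≡⟨ sum-tight (λ x → 𝟙 (used x) * e x) (λ x → 𝟙 (used x) * (e x * e x))
                                       (λ x → *-monoʳ-≤ (𝟙 (used x)) (n≤n*n (e x))) (≤-reflexive E₂≡R) x ⟩
        𝟙 (used x) * (e x * e x)  ≡⟨ cong (_* (e x * e x)) (𝟙-true x-used) ⟩
        1 * (e x * e x)           ≡⟨ *-identityˡ (e x * e x) ⟩
        e x * e x                 ∎)
        where open ≡-Reasoning

      deficient : Fin m → Bool
      deficient x = is-one (e x)

      𝟙-deficient : ∀ {x} → used x ≡ true → 𝟙 (deficient x) ≡ e x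
      𝟙-deficient x-used = 𝟙-is-one (e≤1 x-used)

      nondeficient⇒deg≡s : ∀ {x} → used x ≡ true → deficient x ≡ false → deg x ≡ s
      nondeficient⇒deg≡s {x} x-used not-deficient = trans (sym (+-identityʳ (deg x)))
        (trans (cong (deg x +_) (trans (sym (𝟙-false not-deficient)) (𝟙-deficient x-used))) (deg+e x))

      deficient-in : ∀ v → ∃[ x ] (inc v x ≡ true × deficient x ≡ true)
      deficient-in v with positive-term (λ x → 𝟙 (inc v x) * e x) (≤-reflexive (sym (trans (defect≡c v) c≡1)))
      ... | x , pos with 𝟙*-pos (e x) pos
      ...   | v∋x , 1≤e = x , v∋x , cong is-one (≤-antisym (e≤1 (used-if-in v v∋x)) 1≤e)

      deficient-in-unique : ∀ {v x y} → inc v x ≡ true → deficient x ≡ true →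
                            inc v y ≡ true → deficient y ≡ true → x ≡ y
      deficient-in-unique {v} v∋x dx v∋y dy = sum≡1-unique (λ x → 𝟙 (inc v x) * e x) (trans (defect≡c v) c≡1)
        (≤-reflexive (sym (cong₂ _*_ (𝟙-true v∋x) (is-one⇒≡1 dx))))
        (≤-reflexive (sym (cong₂ _*_ (𝟙-true v∋y) (is-one⇒≡1 dy))))

      -- The plane on the vertices plus a new point ∞ = fromℕ n, which lies on
      -- the lines labelled by deficient elements.
      module Plane (4≤n : 4 ≤ n) where

        r≥2 : 2 ≤ r
        r≥2 = order≥2 r 0 z≤n (subst (4 ≤_) n≡r²+r 4≤n)

        ∞ : Fin (suc n)
        ∞ = fromℕ n

        incidence : Fin ∣ 𝐒 S ∣ → Fin (suc n) → Bool
        incidence i = extend (λ v → inc v (lab i)) (deficient (lab i))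

        line : Fin ∣ 𝐒 S ∣ → Subset (suc n)
        line i = tabulate (incidence i)

        on-line : ∀ i v → lookup (line i) (inject₁ v) ≡ inc v (lab i)
        on-line i v = trans (lookup∘tabulate (incidence i) (inject₁ v))
                            (extend-inject₁ (λ v → inc v (lab i)) (deficient (lab i)) v)

        ∞-on-line : ∀ i → lookup (line i) ∞ ≡ deficient (lab i)
        ∞-on-line i = trans (lookup∘tabulate (incidence i) ∞) (extend-fromℕ (λ v → inc v (lab i)) (deficient (lab i)))

        open Dual line inject₁ on-line

        joined-to-∞ : ∀ v → ∃[ i ] (lookup (line i) (inject₁ v) ≡ true × lookup (line i) ∞ ≡ true)
        joined-to-∞ v =
          let (x , v∋x , x-deficient) = deficient-in v
              (i , lab-i≡x) = label-of v∋x
          in i , trans (on-line i v) (subst (λ y → inc v y ≡ true) (sym lab-i≡x) v∋x)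
               , trans (∞-on-line i) (subst (λ y → deficient y ≡ true) (sym lab-i≡x) x-deficient)

        joined-to-∞-once : ∀ {v i j} → lookup (line i) (inject₁ v) ≡ true → lookup (line i) ∞ ≡ true →
                           lookup (line j) (inject₁ v) ≡ true → lookup (line j) ∞ ≡ true → i ≡ j
        joined-to-∞-once {v} {i} {j} v∈i ∞∈i v∈j ∞∈j = enum-injective (𝐒 S)
          (deficient-in-unique (trans (sym (on-line i v)) v∈i) (trans (sym (∞-on-line i)) ∞∈i)
                               (trans (sym (on-line j v)) v∈j) (trans (sym (∞-on-line j)) ∞∈j))

        joined : ∀ a b → b ≢ a → ∃[ i ] (lookup (line i) a ≡ true × lookup (line i) b ≡ true)
        joined a b b≢a with old-or-new a | old-or-new b
        ... | inj₁ (a′ , refl) | inj₁ (b′ , refl) = joined-vertices {a′} {b′} (λ b′≡a′ → b≢a (cong inject₁ b′≡a′))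
        ... | inj₁ (a′ , refl) | inj₂ refl        = joined-to-∞ a′
        ... | inj₂ refl        | inj₁ (b′ , refl) = let (i , b∈ , ∞∈) = joined-to-∞ b′ in i , ∞∈ , b∈
        ... | inj₂ refl        | inj₂ refl        = ⊥-elim (b≢a refl)

        joined-once : ∀ {a b i j} → b ≢ a → lookup (line i) a ≡ true → lookup (line i) b ≡ true →
                      lookup (line j) a ≡ true → lookup (line j) b ≡ true → i ≡ j
        joined-once {a} {b} {i} {j} b≢a a∈i b∈i a∈j b∈j with old-or-new a | old-or-new b
        ... | inj₁ (a′ , refl) | inj₁ (b′ , refl) =
          joined-vertices-once {a′} {b′} {i} {j} (λ b′≡a′ → b≢a (cong inject₁ b′≡a′)) a∈i b∈i a∈j b∈j
        ... | inj₁ (a′ , refl) | inj₂ refl = joined-to-∞-once {a′} {i} {j} a∈i b∈i a∈j b∈j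
        ... | inj₂ refl | inj₁ (b′ , refl) = joined-to-∞-once {b′} {i} {j} b∈i a∈i b∈j a∈j
        ... | inj₂ refl | inj₂ refl        = ⊥-elim (b≢a refl)

        full : ∀ k → deficient (lab k) ≡ false → deg (lab k) * r + 1 ≡ V
        full k not-deficient = trans (full-degree (nondeficient⇒deg≡s (lab-used k) not-deficient))
          (trans (+-comm (r * r + r) 1) (trans (cong suc (sym (trans n≡r²+r (+-identityʳ _)))) (sym V≡n+1)))

        -- a line of a non-deficient element meets every other line in a vertex;
        -- two lines of deficient elements meet in ∞
        meet : ∀ i j → j ≢ i → ∃[ x ] (lookup (line i) x ≡ true × lookup (line j) x ≡ true)
        meet i j j≢i with true-or-false (deficient (lab i)) | true-or-false (deficient (lab j))
        ... | inj₂ dᵢ | _ = let (v , v∈i , v∈j) = lines-meet j≢i (full i dᵢ) in inject₁ v , v∈i , v∈j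
        ... | inj₁ dᵢ | inj₂ dⱼ = let (v , v∈j , v∈i) = lines-meet (≢-sym j≢i) (full j dⱼ)
                             in inject₁ v , v∈i , v∈j
        ... | inj₁ dᵢ | inj₁ dⱼ = ∞ , trans (∞-on-line i) dᵢ , trans (∞-on-line j) dⱼ

        ∣line∣≡s : ∀ i → ∣ line i ∣ ≡ s
        ∣line∣≡s i = begin
          ∣ line i ∣                                                   ≡⟨ card-tabulate (incidence i) ⟩
          sum (λ x → 𝟙 (incidence i x))                                ≡⟨ sum-init-last (λ x → 𝟙 (incidence i x)) ⟩
          sum (λ v → 𝟙 (incidence i (inject₁ v))) + 𝟙 (incidence i ∞)  ≡⟨ cong₂ _+_ (sum-cong-≗ (λ v → cong 𝟙 (trans (sym (lookup∘tabulate (incidence i) (inject₁ v))) (on-line i v))))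
                                                                                    (cong 𝟙 (trans (sym (lookup∘tabulate (incidence i) ∞)) (∞-on-line i))) ⟩
          deg (lab i) + 𝟙 (deficient (lab i))                          ≡⟨ cong (deg (lab i) +_) (𝟙-deficient (lab-used i)) ⟩
          deg (lab i) + e (lab i)                                      ≡⟨ deg+e (lab i) ⟩
          s                                                            ∎
          where open ≡-Reasoning

        lines-through-∞ : sum (λ i → 𝟙 (lookup (line i) ∞)) ≡ s
        lines-through-∞ = begin
          sum (λ i → 𝟙 (lookup (line i) ∞))            ≡⟨ sum-cong-≗ (λ i → cong 𝟙 (∞-on-line i)) ⟩
          sum (λ i → 𝟙 (deficient (lab i)))           ≡⟨ sum-enum (𝐒 S) (λ x → 𝟙 (deficient x)) ⟩
          sum (λ x → 𝟙 (used x) * 𝟙 (deficient x))    ≡⟨ sum-cong-≗ only-used ⟩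
          R                                           ≡⟨ R≡s ⟩
          s                                           ∎
          where
          open ≡-Reasoning
          only-used : ∀ x → 𝟙 (used x) * 𝟙 (deficient x) ≡ 𝟙 (used x) * e x
          only-used x with true-or-false (used x)
          ... | inj₁ x-used  = cong (𝟙 (used x) *_) (𝟙-deficient x-used)
          ... | inj₂ unused rewrite unused = refl

        lines-through : ∀ x → sum (λ i → 𝟙 (lookup (line i) x)) ≡ s
        lines-through x with old-or-new x
        ... | inj₁ (v , refl) = lines-through-vertex v
        ... | inj₂ refl       = lines-through-∞

        plane : ProjectivePlane (suc n) ∣ 𝐒 S ∣
        plane = FromIncidence.plane line joined-once joined meet
          (λ i → subst (3 ≤_) (sym (∣line∣≡s i)) (thick r≥2))
          (subst (2 ≤_) (sym (trans ∣𝐒∣≡V V≡n+1)) (≤-trans n≥2 (n≤1+n n)))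

        n+1≡r²+r+1 : suc n ≡ r * r + r + 1
        n+1≡r²+r+1 = trans (cong suc (trans n≡r²+r (+-identityʳ _))) (+-comm 1 (r * r + r))

        order : HasOrder plane r
        order = r≥2 , n+1≡r²+r+1 , trans ∣𝐒∣≡V (trans V≡n+1 n+1≡r²+r+1) ,
                (λ i → trans (∣line∣≡s i) s≡r+1) ,
                (λ x → trans (card-tabulate (λ i → lookup (line i) x)) (trans (lines-through x) s≡r+1))

        typeP⁻ : TypePminus S
        typeP⁻ = r , ∣ 𝐒 S ∣ , plane , order , lab , enum-injective (𝐒 S) , represents

  n≤V : n ≤ V
  n≤V with star-or-not
  ... | inj₁ (c , in-all) = ≤-trans (n≤1+n n) (Star.V>n c in-all)
  ... | inj₂ misses       = NoStar.V≥n misses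

  V≡n⇒ : V ≡ n → (∃[ r ] n ≡ r * r + r + 1) × (4 ≤ n → TypeP S)
  V≡n⇒ V≡n with star-or-not
  ... | inj₁ (c , in-all) = ⊥-elim (1+n≰n (subst (suc n ≤_) V≡n (Star.V>n c in-all)))
  ... | inj₂ misses       = (r , n≡r²+r+1) , Plane.typeP
    where open NoStar misses
          open Tight V≡n

  V≡n+1⇒ : V ≡ suc n → TypeN S ⊎ ((∃[ r ] n ≡ r * r + r) × (4 ≤ n → TypePminus S))
  V≡n+1⇒ V≡n+1 with star-or-not
  ... | inj₁ (c , in-all) = inj₁ (Star.typeN c in-all (Star.V≡n+1⇒s≡2 c in-all V≡n+1))
  ... | inj₂ misses       = inj₂ ((r , trans n≡r²+r (+-identityʳ _)) , Plane.typeP⁻)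
    where open NoStar misses
          open OneMore V≡n+1

module Triangle {m : ℕ} (S : Family 3 m) (U : IsUniformRepresentation (K 3) S) where

  v₀ v₁ v₂ : Fin 3
  v₀ = zero
  v₁ = suc zero
  v₂ = suc (suc zero)

  open Counting S U v₀ v₁ (λ ())

  module Tight3 (misses : ∀ x → ∃[ w ] inc w x ≡ false) (V≡3 : V ≡ 3) where
    open NoStar misses using (r; s≡1+r)
    open NoStar.Tight misses V≡3 using (n≡r²+r+1)

    s≡2 : s ≡ 2
    s≡2 = trans s≡1+r (cong suc (three≡r²+r+1 r n≡r²+r+1))

    ∣S∣≡2 : ∀ v → ∣ S v ∣ ≡ 2
    ∣S∣≡2 v = trans (card (S v)) (trans (size v) s≡2)

    -- a is the common element of S v₀ and S v₁, b and c their other elements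
    module Named {a b c : Fin m} (v₀∋a : inc v₀ a ≡ true) (v₁∋a : inc v₁ a ≡ true)
                 (b≢a : b ≢ a) (v₀∋b : inc v₀ b ≡ true) (c≢a : c ≢ a) (v₁∋c : inc v₁ c ≡ true) where

      S₀ : S v₀ ≡ ⁅ a ⁆ ∪ ⁅ b ⁆
      S₀ = two-element-set (S v₀) (∣S∣≡2 v₀) b≢a v₀∋a v₀∋b

      S₁ : S v₁ ≡ ⁅ a ⁆ ∪ ⁅ c ⁆
      S₁ = two-element-set (S v₁) (∣S∣≡2 v₁) c≢a v₁∋a v₁∋c

      -- b and c are distinct, since S v₀ and S v₁ share only a
      c≢b : c ≢ b
      c≢b c≡b = b≢a (sym (common-element-unique {v₀} {v₁} (λ ()) v₀∋a v₁∋a v₀∋b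
                            (subst (λ z → inc v₁ z ≡ true) c≡b v₁∋c)))

      -- a, already in S v₀ and S v₁, is missed by the third set
      v₂∌a : inc v₂ a ≡ false
      v₂∌a with misses a
      ... | zero , v₀∌a           = ⊥-elim (false≢true (trans (sym v₀∌a) v₀∋a))
      ... | suc zero , v₁∌a       = ⊥-elim (false≢true (trans (sym v₁∌a) v₁∋a))
      ... | suc (suc zero) , v₂∌a = v₂∌a

      meets-at : ∀ {v z} → v ≢ v₂ → S v ≡ ⁅ a ⁆ ∪ ⁅ z ⁆ → inc v₂ z ≡ true
      meets-at {v} {z} v≢v₂ S-v with common-element v≢v₂
      ... | y , v∋y , v₂∋y with ∈-pair (subst (λ A → lookup A y ≡ true) S-v v∋y)
      ...   | inj₁ y≡a = ⊥-elim (false≢true (trans (sym v₂∌a) (subst (λ x → inc v₂ x ≡ true) y≡a v₂∋y)))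
      ...   | inj₂ y≡z = subst (λ x → inc v₂ x ≡ true) y≡z v₂∋y

      S₂ : S v₂ ≡ ⁅ b ⁆ ∪ ⁅ c ⁆
      S₂ = two-element-set (S v₂) (∣S∣≡2 v₂) c≢b (meets-at (λ ()) S₀) (meets-at (λ ()) S₁)

      cases : ∀ v → S v ≡ ⁅ a ⁆ ∪ ⁅ b ⁆ ⊎ S v ≡ ⁅ a ⁆ ∪ ⁅ c ⁆ ⊎ S v ≡ ⁅ b ⁆ ∪ ⁅ c ⁆
      cases zero             = inj₁ S₀
      cases (suc zero)       = inj₂ (inj₁ S₁)
      cases (suc (suc zero)) = inj₂ (inj₂ S₂)

      typeT : TypeT S
      typeT = a , b , c , (≢-sym b≢a) , (≢-sym c≢a) , (≢-sym c≢b) ,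
              cases , (v₀ , S₀) , (v₁ , S₁) , (v₂ , S₂)

    typeT : TypeT S
    typeT with common-element {v₀} {v₁} (λ ())
    ... | a , v₀∋a , v₁∋a
      with another-element (S v₀) (≤-reflexive (sym (∣S∣≡2 v₀))) v₀∋a
         | another-element (S v₁) (≤-reflexive (sym (∣S∣≡2 v₁))) v₁∋a
    ... | b , b≢a , v₀∋b | c , c≢a , v₁∋c = Named.typeT v₀∋a v₁∋a b≢a v₀∋b c≢a v₁∋c

  triangle : ∣ 𝐒 S ∣ ≡ 3 → TypeT S
  triangle ∣𝐒S∣≡3 with star-or-not
  ... | inj₁ (c , in-all) = ⊥-elim (1+n≰n (subst (4 ≤_) (trans (sym ∣𝐒∣≡V) ∣𝐒S∣≡3) (Star.V>n c in-all)))
  ... | inj₂ misses       = Tight3.typeT misses (trans (sym ∣𝐒∣≡V) ∣𝐒S∣≡3)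

-- A family whose members have size s and pairwise meet in one element is a
-- uniform representation of K_n, provided the members have size at least 2
-- (this makes distinct members distinct sets).
uniform-of-K : ∀ {n m} (S : Family n m) (s : ℕ) → 2 ≤ s → (∀ v → ∣ S v ∣ ≡ s) →
               (∀ u v → u ≢ v → ∣ S u ∩ S v ∣ ≡ 1) → IsUniformRepresentation (K n) S
uniform-of-K S s 2≤s ∣S∣≡s meet-once =
  ((λ v → nonempty (S v) (≤-trans (s≤s z≤n) (subst (2 ≤_) (sym (∣S∣≡s v)) 2≤s))) ,
   (λ u v u≢v → (λ _ → meet-once u v u≢v) , (λ not-adjacent → ⊥-elim (not-adjacent u≢v)))) ,
  injective , (λ u v → trans (∣S∣≡s u) (sym (∣S∣≡s v)))
  where
  injective : ∀ {u v} → S u ≡ S v → u ≡ v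
  injective {u} {v} Su≡Sv with u ≟ᶠ v
  ... | yes u≡v = u≡v
  ... | no u≢v  = ⊥-elim (1+n≰n (subst (2 ≤_) (begin
          s                                                 ≡⟨ sym (∣S∣≡s u) ⟩
          ∣ S u ∣                                           ≡⟨ card (S u) ⟩
          sum (λ x → 𝟙 (lookup (S u) x))                    ≡⟨ sum-cong-≗ (λ x → sym (𝟙-idem (lookup (S u) x))) ⟩
          sum (λ x → 𝟙 (lookup (S u) x) * 𝟙 (lookup (S u) x)) ≡⟨ cong (λ A → sum (λ x → 𝟙 (lookup (S u) x) * 𝟙 (lookup A x))) Su≡Sv ⟩
          sum (λ x → 𝟙 (lookup (S u) x) * 𝟙 (lookup (S v) x)) ≡⟨ sym (card-∩ (S u) (S v)) ⟩
          ∣ S u ∩ S v ∣                                     ≡⟨ meet-once u v u≢v ⟩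
          1                                                 ∎) 2≤s))
    where open ≡-Reasoning

module Near (n : ℕ) where

  near : Family n (suc n)
  near v = ⁅ zero ⁆ ∪ ⁅ suc v ⁆

  lookup-near : ∀ v y → lookup (near v) (suc y) ≡ does (y ≟ᶠ v)
  lookup-near v y = trans (lookup-∪ ⁅ zero ⁆ ⁅ suc v ⁆ (suc y))
                          (cong₂ _∨_ (lookup-⁅⁆ {suc n} zero (suc y)) (lookup-⁅⁆ (suc v) (suc y)))

  is-self : ∀ (y : Fin n) → does (y ≟ᶠ y) ≡ true
  is-self y with y ≟ᶠ y
  ... | yes _   = refl
  ... | no y≢y  = ⊥-elim (y≢y refl)

  ∣near∣ : ∀ v → ∣ near v ∣ ≡ 2
  ∣near∣ v = trans (card (near v)) (cong suc (trans (sum-cong-≗ (λ y → cong 𝟙 (lookup-near v y)))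
    (count≡1 (λ y → does (y ≟ᶠ v)) v (is-self v) only-v)))
    where
    only-v : ∀ y → does (y ≟ᶠ v) ≡ true → y ≡ v
    only-v y _ with y ≟ᶠ v
    only-v y _    | yes y≡v = y≡v
    only-v y ()   | no _

  near-meet : ∀ u v → u ≢ v → ∣ near u ∩ near v ∣ ≡ 1
  near-meet u v u≢v = trans (card-∩ (near u) (near v))
    (cong suc (trans (sum-cong-≗ apart) (sum-zero {n})))
    where
    apart : ∀ y → 𝟙 (lookup (near u) (suc y)) * 𝟙 (lookup (near v) (suc y)) ≡ 0
    apart y rewrite lookup-near u y | lookup-near v y with y ≟ᶠ u | y ≟ᶠ v
    ... | yes refl | yes refl = ⊥-elim (u≢v refl)
    ... | yes _    | no _     = refl
    ... | no _     | _        = refl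

  near-uniform : IsUniformRepresentation (K n) near
  near-uniform = uniform-of-K near 2 ≤-refl ∣near∣ near-meet

  -- (any vertex w witnesses that the common element 0 is used)
  ∣𝐒near∣ : Fin n → ∣ 𝐒 near ∣ ≡ suc n
  ∣𝐒near∣ w = ∣𝐒∣-full near used
    where
    used : ∀ x → ∃[ v ] lookup (near v) x ≡ true
    used zero    = w , refl
    used (suc y) = y , trans (lookup-near y y) (is-self y)

  near-typeN : TypeN near
  near-typeN = zero , suc , fsuc-injective , (λ v ()) , (λ v → refl)

module Pencils {p l n : ℕ} (P : ProjectivePlane p l) (k : ℕ) (order : HasOrder P k)
               (ι : Fin n → Fin p) (ι-injective : ∀ {a b} → ι a ≡ ι b → a ≡ b) where

  open ProjectivePlane P

  pencil : Family n l
  pencil v = linesThrough (ι v)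

  lookup-pencil : ∀ v i → lookup (pencil v) i ≡ lookup (line i) (ι v)
  lookup-pencil v i = lookup∘tabulate (λ i → lookup (line i) (ι v)) i

  ∣pencil∣ : ∀ v → ∣ pencil v ∣ ≡ k + 1
  ∣pencil∣ v = proj₂ (proj₂ (proj₂ (proj₂ order))) (ι v)

  -- two points span exactly one line
  pencil-meet : ∀ u v → u ≢ v → ∣ pencil u ∩ pencil v ∣ ≡ 1
  pencil-meet u v u≢v with two-points (ι u) (ι v) (λ ιu≡ιv → u≢v (ι-injective ιu≡ιv))
  ... | i , u∈i , v∈i , only-i = trans (card-∩ (pencil u) (pencil v))
    (trans (sum-cong-≗ (λ j → trans (cong₂ (λ a b → 𝟙 a * 𝟙 b) (lookup-pencil u j) (lookup-pencil v j))
                                    (sym (𝟙-∧ (lookup (line j) (ι u)) (lookup (line j) (ι v))))))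
           (count≡1 (λ j → lookup (line j) (ι u) ∧ lookup (line j) (ι v)) i
                    (cong₂ _∧_ (∈⇒lookup u∈i) (∈⇒lookup v∈i))
                    (λ j both → let (u∈j , v∈j) = ∧-true both in only-i j (lookup⇒∈ u∈j) (lookup⇒∈ v∈j))))

  -- the lines themselves serve as labels
  pencil-represents : ∀ v i → (i ∈ pencil v) ⇔ (∃[ j ] (j ≡ i × ι v ∈ line j))
  pencil-represents v i = mk⇔
    (λ i∈ → i , refl , lookup⇒∈ (trans (sym (lookup-pencil v i)) (∈⇒lookup i∈)))
    (λ { (j , refl , v∈j) → lookup⇒∈ (trans (lookup-pencil v j) (∈⇒lookup v∈j)) })

  pencil-uniform : IsUniformRepresentation (K n) pencil
  pencil-uniform = uniform-of-K pencil (k + 1) (≤-trans (proj₁ order) (m≤m+n k 1)) ∣pencil∣ pencil-meet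

  ∣𝐒pencil∣ : (∀ i → ∃[ v ] lookup (line i) (ι v) ≡ true) → ∣ 𝐒 pencil ∣ ≡ l
  ∣𝐒pencil∣ hits = ∣𝐒∣-full pencil (λ i → let (v , v∈i) = hits i in v , trans (lookup-pencil v i) v∈i)

triangle : Family 3 3
triangle zero             = true  ∷ true  ∷ false ∷ []
triangle (suc zero)       = true  ∷ false ∷ true  ∷ []
triangle (suc (suc zero)) = false ∷ true  ∷ true  ∷ []

triangle-uniform : IsUniformRepresentation (K 3) triangle
triangle-uniform = uniform-of-K triangle 2 ≤-refl size meet
  where
  size : ∀ v → ∣ triangle v ∣ ≡ 2
  size zero             = refl
  size (suc zero)       = refl
  size (suc (suc zero)) = refl
  meet : ∀ u v → u ≢ v → ∣ triangle u ∩ triangle v ∣ ≡ 1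
  meet zero             zero             u≢v = ⊥-elim (u≢v refl)
  meet zero             (suc zero)       _   = refl
  meet zero             (suc (suc zero)) _   = refl
  meet (suc zero)       zero             _   = refl
  meet (suc zero)       (suc zero)       u≢v = ⊥-elim (u≢v refl)
  meet (suc zero)       (suc (suc zero)) _   = refl
  meet (suc (suc zero)) zero             _   = refl
  meet (suc (suc zero)) (suc zero)       _   = refl
  meet (suc (suc zero)) (suc (suc zero)) u≢v = ⊥-elim (u≢v refl)

∣𝐒triangle∣ : ∣ 𝐒 triangle ∣ ≡ 3
∣𝐒triangle∣ = refl

minimum-size : ∀ {n m} {G : Graph n} {S : Family n m} {w : ℕ} → IsMinUniformRepresentation G S →
  (∀ m′ (S′ : Family n m′) → IsUniformRepresentation G S′ → w ≤ ∣ 𝐒 S′ ∣) →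
  (∃[ m′ ] Σ (Family n m′) λ S′ → IsUniformRepresentation G S′ × ∣ 𝐒 S′ ∣ ≡ w) → ∣ 𝐒 S ∣ ≡ w
minimum-size {m = m} {S = S} (U , minimal) lower (m′ , S′ , U′ , ∣𝐒S′∣≡w) =
  ≤-antisym (subst (∣ 𝐒 S ∣ ≤_) ∣𝐒S′∣≡w (minimal m′ S′ U′)) (lower m S U)

attains-minimum : ∀ {n m} {G : Graph n} {S : Family n m} {w : ℕ} → UniformIntersectionNumber G w →
  IsUniformRepresentation G S → ∣ 𝐒 S ∣ ≡ w → IsMinUniformRepresentation G S
attains-minimum (_ , lower) U ∣𝐒S∣≡w = U , λ m′ S′ U′ → subst (_≤ ∣ 𝐒 S′ ∣) (sym ∣𝐒S∣≡w) (lower m′ S′ U′)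

module Bounds {n : ℕ} (2≤n : 2 ≤ n) where

  w₀ w₁ : Fin n
  w₀ = proj₁ (two-indices 2≤n)
  w₁ = proj₁ (proj₂ (two-indices 2≤n))

  module C {m : ℕ} (S : Family n m) (U : IsUniformRepresentation (K n) S) =
    Counting S U w₀ w₁ (proj₂ (proj₂ (two-indices 2≤n)))

  n≤∣𝐒∣ : ∀ m (S : Family n m) → IsUniformRepresentation (K n) S → n ≤ ∣ 𝐒 S ∣
  n≤∣𝐒∣ m S U = subst (n ≤_) (sym (C.∣𝐒∣≡V S U)) (C.n≤V S U)

  ∣𝐒∣≡n⇒ : ∀ {m} (S : Family n m) → IsUniformRepresentation (K n) S → ∣ 𝐒 S ∣ ≡ n →
           (∃[ r ] n ≡ r * r + r + 1) × (4 ≤ n → TypeP S)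
  ∣𝐒∣≡n⇒ S U ∣𝐒S∣≡n = C.V≡n⇒ S U (trans (sym (C.∣𝐒∣≡V S U)) ∣𝐒S∣≡n)

  ∣𝐒∣≡n+1⇒ : ∀ {m} (S : Family n m) → IsUniformRepresentation (K n) S → ∣ 𝐒 S ∣ ≡ suc n →
             TypeN S ⊎ ((∃[ r ] n ≡ r * r + r) × (4 ≤ n → TypePminus S))
  ∣𝐒∣≡n+1⇒ S U ∣𝐒S∣≡n+1 = C.V≡n+1⇒ S U (trans (sym (C.∣𝐒∣≡V S U)) ∣𝐒S∣≡n+1)

  n<∣𝐒∣ : (∀ r → n ≢ r * r + r + 1) →
          ∀ m (S : Family n m) → IsUniformRepresentation (K n) S → suc n ≤ ∣ 𝐒 S ∣
  n<∣𝐒∣ not-projective m S U =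
    ≤∧≢⇒< (n≤∣𝐒∣ m S U) (λ n≡∣𝐒S∣ → let ((r , n≡) , _) = ∣𝐒∣≡n⇒ S U (sym n≡∣𝐒S∣) in not-projective r n≡)

  near-attains : ∃[ m ] Σ (Family n m) λ S → IsUniformRepresentation (K n) S × ∣ 𝐒 S ∣ ≡ suc n
  near-attains = suc n , Near.near n , Near.near-uniform n , Near.∣𝐒near∣ n w₀

  ω≡n+1 : (∀ r → n ≢ r * r + r + 1) → UniformIntersectionNumber (K n) (suc n)
  ω≡n+1 not-projective = near-attains , n<∣𝐒∣ not-projective

part1 : UniformIntersectionNumber (K 3) 3 ×
        (∀ m (S : Family 3 m) → IsMinUniformRepresentation (K 3) S → TypeT S)
part1 = ω≡3 , λ m S min → Triangle.triangle S (proj₁ min) (minimum-size min (proj₂ ω≡3) (proj₁ ω≡3))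
  where
  ω≡3 : UniformIntersectionNumber (K 3) 3
  ω≡3 = (3 , triangle , triangle-uniform , ∣𝐒triangle∣) , Bounds.n≤∣𝐒∣ (s≤s (s≤s z≤n))

plane-on : ∀ {p k} → ProjectivePlaneOfOrderExists k → p ≡ k * k + k + 1 →
           ∃[ l ] Σ (ProjectivePlane p l) λ P → HasOrder P k
plane-on (p′ , l , P , order) p≡ with trans (proj₁ (proj₂ order)) (sym p≡)
... | refl = l , P , order

module ProjectiveCase {n k l : ℕ} (4≤n : 4 ≤ n) (P : ProjectivePlane n l) (order : HasOrder P k)
                      (n≡k²+k+1 : n ≡ k * k + k + 1) where

  open ProjectivePlane P using (line; line-size)
  open Pencils P k order (λ v → v) (λ ι≡ → ι≡)
  open Bounds (≤-trans (s≤s (s≤s z≤n)) 4≤n)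

  pencils-attain : ∃[ m ] Σ (Family n m) λ S → IsUniformRepresentation (K n) S × ∣ 𝐒 S ∣ ≡ n
  pencils-attain = l , pencil , pencil-uniform , trans (∣𝐒pencil∣ hits) (trans (proj₁ (proj₂ (proj₂ order))) (sym n≡k²+k+1))
    where
    hits : ∀ i → ∃[ v ] lookup (line i) v ≡ true
    hits i = let (v , v∈i) = nonempty (line i) (≤-trans (s≤s z≤n) (line-size i)) in v , ∈⇒lookup v∈i

  result : UniformIntersectionNumber (K n) n ×
           (∀ m (S : Family n m) → IsMinUniformRepresentation (K n) S → TypeP S)
  result = (pencils-attain , n≤∣𝐒∣) ,
           λ m S min → proj₂ (∣𝐒∣≡n⇒ S (proj₁ min) (minimum-size min n≤∣𝐒∣ pencils-attain)) 4≤n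

module AffineCase {n k l : ℕ} (4≤n : 4 ≤ n) (P : ProjectivePlane (suc n) l) (order : HasOrder P k)
                  (n≡k²+k : n ≡ k * k + k) where

  open ProjectivePlane P using (line; line-size)
  open Pencils P k order inject₁ inject₁-injective
  open Bounds (≤-trans (s≤s (s≤s z≤n)) 4≤n)

  not-projective : ∀ r → n ≢ r * r + r + 1
  not-projective r n≡r²+r+1 = projective≢affine r k (trans (sym n≡r²+r+1) n≡k²+k)

  ω : UniformIntersectionNumber (K n) (suc n)
  ω = ω≡n+1 not-projective

  hits : ∀ i → ∃[ v ] lookup (line i) (inject₁ v) ≡ true
  hits i with two-positive-terms (λ x → 𝟙 (lookup (line i) x)) (λ x → 𝟙≤1 (lookup (line i) x))
                (subst (2 ≤_) (card (line i)) (line-size i))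
  ... | a , b , b≢a , a∈i , b∈i with old-or-new a | old-or-new b
  ...   | inj₁ (v , refl) | _               = v , 𝟙-pos a∈i
  ...   | inj₂ refl       | inj₁ (v , refl) = v , 𝟙-pos b∈i
  ...   | inj₂ refl       | inj₂ refl       = ⊥-elim (b≢a refl)

  pencils-minimum : IsMinUniformRepresentation (K n) pencil
  pencils-minimum = attains-minimum ω pencil-uniform
    (trans (∣𝐒pencil∣ hits) (trans (proj₁ (proj₂ (proj₂ order))) (trans (+-comm (k * k + k) 1) (cong suc (sym n≡k²+k)))))

  near-minimum : IsMinUniformRepresentation (K n) (Near.near n)
  near-minimum = attains-minimum ω (Near.near-uniform n) (Near.∣𝐒near∣ n w₀)

  result : UniformIntersectionNumber (K n) (suc n) ×
           (∀ m (S : Family n m) → IsMinUniformRepresentation (K n) S → TypeN S ⊎ TypePminus S) ×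
           (∃[ m ] Σ (Family n m) λ S → IsMinUniformRepresentation (K n) S × TypeN S) ×
           (∃[ m ] Σ (Family n m) λ S → IsMinUniformRepresentation (K n) S × TypePminus S)
  result = ω , classify ,
           (suc n , Near.near n , near-minimum , Near.near-typeN n) ,
           (l , pencil , pencils-minimum , (k , l , P , order , (λ i → i) , (λ i≡j → i≡j) , pencil-represents))
    where
    classify : ∀ m (S : Family n m) → IsMinUniformRepresentation (K n) S → TypeN S ⊎ TypePminus S
    classify m S min with ∣𝐒∣≡n+1⇒ S (proj₁ min) (minimum-size min (proj₂ ω) (proj₁ ω))
    ... | inj₁ typeN           = inj₁ typeN
    ... | inj₂ (_ , typeP⁻)    = inj₂ (typeP⁻ 4≤n)

part4 : ∀ n → 4 ≤ n → (∀ k → 2 ≤ k → n ≢ k * k + k + 1 × n ≢ k * k + k) →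
        UniformIntersectionNumber (K n) (suc n) ×
        (∀ m (S : Family n m) → IsMinUniformRepresentation (K n) S → TypeN S)
part4 n 4≤n neither = ω , classify
  where
  open Bounds (≤-trans (s≤s (s≤s z≤n)) 4≤n)
  ω : UniformIntersectionNumber (K n) (suc n)
  ω = ω≡n+1 (λ r n≡ → proj₁ (neither r (order≥2 r 1 ≤-refl (subst (4 ≤_) n≡ 4≤n))) n≡)
  classify : ∀ m (S : Family n m) → IsMinUniformRepresentation (K n) S → TypeN S
  classify m S min with ∣𝐒∣≡n+1⇒ S (proj₁ min) (minimum-size min (proj₂ ω) (proj₁ ω))
  ... | inj₁ typeN          = typeN
  ... | inj₂ ((r , n≡) , _) =
    ⊥-elim (proj₂ (neither r (order≥2 r 0 z≤n (subst (4 ≤_) (trans n≡ (sym (+-identityʳ _))) 4≤n))) n≡)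

part2 : ∀ n k → 4 ≤ n → 2 ≤ k → n ≡ k * k + k + 1 → ProjectivePlaneOfOrderExists k →
        UniformIntersectionNumber (K n) n ×
        (∀ m (S : Family n m) → IsMinUniformRepresentation (K n) S → TypeP S)
part2 n k 4≤n _ n≡ plane = let (l , P , order) = plane-on plane n≡ in ProjectiveCase.result 4≤n P order n≡

part3 : ∀ n k → 4 ≤ n → 2 ≤ k → n ≡ k * k + k → ProjectivePlaneOfOrderExists k →
        UniformIntersectionNumber (K n) (suc n) ×
        (∀ m (S : Family n m) → IsMinUniformRepresentation (K n) S → TypeN S ⊎ TypePminus S) ×
        (∃[ m ] Σ (Family n m) λ S → IsMinUniformRepresentation (K n) S × TypeN S) ×
        (∃[ m ] Σ (Family n m) λ S → IsMinUniformRepresentation (K n) S × TypePminus S)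
part3 n k 4≤n _ n≡ plane =
  let (l , P , order) = plane-on plane (trans (cong suc n≡) (+-comm 1 (k * k + k))) in AffineCase.result 4≤n P order n≡

theorem3p4 :
    (UniformIntersectionNumber (K 3) 3 ×
     (∀ m (S : Family 3 m) → IsMinUniformRepresentation (K 3) S → TypeT S)) ×
    (∀ n k → 4 ≤ n → 2 ≤ k → n ≡ k * k + k + 1 → ProjectivePlaneOfOrderExists k →
       UniformIntersectionNumber (K n) n ×
       (∀ m (S : Family n m) → IsMinUniformRepresentation (K n) S → TypeP S)) ×
    (∀ n k → 4 ≤ n → 2 ≤ k → n ≡ k * k + k → ProjectivePlaneOfOrderExists k →
       UniformIntersectionNumber (K n) (suc n) ×
       (∀ m (S : Family n m) → IsMinUniformRepresentation (K n) S →
          TypeN S ⊎ TypePminus S) ×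
       (∃[ m ] Σ (Family n m) λ S → IsMinUniformRepresentation (K n) S × TypeN S) ×
       (∃[ m ] Σ (Family n m) λ S → IsMinUniformRepresentation (K n) S × TypePminus S)) ×
    (∀ n → 4 ≤ n → (∀ k → 2 ≤ k → n ≢ k * k + k + 1 × n ≢ k * k + k) →
       UniformIntersectionNumber (K n) (suc n) ×
       (∀ m (S : Family n m) → IsMinUniformRepresentation (K n) S → TypeN S))
theorem3p4 = part1 , part2 , part3 , part4
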